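{- Let $n\ge3$ and $m\ge5$ be integers, $G=\langle x\rangle$ a cyclic group of order $n$, and $\delta\in\{0,\dots,n-1\}$ with $\gcd(1+\delta,n)=1$. Then the automorphism group of the graph $\Delta$ defined below is $G$ (acting by $y_i\mapsto(yg)_i$). Consequently, every cyclic group of order at least $3$ has an $m$-GRR for every $m\ge5$.
   Context: Write $g_i$ for $(g,i)$ and $G_i=G\times\{i\}$. $\Delta$ has vertex set $G\times\{0,\dots,m-1\}$ and edges: no edges inside $G_0$ or $G_3$; $G_1$ and $G_2$ each induce complete graphs; for $i\in\{4,\dots,m-1\}$, edges $\{g_i,(xg)_i\}$ inside $G_i$. Between blocks: $g_0\sim g'_2$ iff $g\ne g'$; $g_2\sim g'_3$ iff $g=g'$; $g_3\sim g'_{m-1}$ iff $g\ne g'$; $g_1\sim g'_4$ iff $g\ne g'$; for $\ell\in\{4,\dots,m-2\}$, $g_\ell\sim g'_{\ell+1}$ iff $g\ne g'$; $g_0\sim g'_3$ for all $g,g'$; $g_0\sim g'_1$ iff $g'g^{ -1}=x$; $g_1\sim g'_2$ iff $g'g^{ -1}=x^\delta$. No other edges. An $m$-GRR of a finite group $G$ is a regular finite simple graph whose automorphism group is isomorphic to $G$ and acts semiregularly (trivial stabilizers) on the vertex set with exactly $m$ orbits. -}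

module Defs where

open import Data.Nat using (ℕ; zero; suc; _+_; _∸_; _≤_; NonZero)
open import Data.Nat.DivMod using (_mod_)
open import Data.Fin using (Fin; toℕ)
open import Data.Bool using (Bool; true; false)
open import Data.Product using (Σ; _×_; _,_; ∃)
open import Data.Sum using (_⊎_)
open import Data.Unit using (⊤)
open import Function.Bundles using (_↔_; _⇔_)
open import Function.Definitions using (Bijective)
open import Relation.Binary.PropositionalEquality using (_≡_; _≢_)

-- The cyclic group G = ⟨x⟩ of order n, modelled as ℤ/nℤ = Fin n with
-- addition mod n; the generator x is the residue 1, x^δ is δ, and the
-- identity is 0.  (G is abelian, so g'g⁻¹ = x  ⇔  g' = g ⊕ x.)

_⊕_ : {n : ℕ} .{{_ : NonZero n}} → Fin n → Fin n → Fin n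
_⊕_ {n} g h = (toℕ g + toℕ h) mod n

gen : (n : ℕ) .{{_ : NonZero n}} → Fin n
gen n = 1 mod n

idG : (n : ℕ) .{{_ : NonZero n}} → Fin n
idG n = 0 mod n

-- The graph Δ on vertex set G × {0,…,m-1}; a vertex (g , i) is g_i.
-- Edge lists each rule of the paper once (one orientation);
-- adjacency Adj is its symmetric closure.

module Delta (n m : ℕ) .{{_ : NonZero n}} (δ : Fin n) where

  V : Set
  V = Fin n × Fin m

  data Edge : V → V → Set where
    e11 : ∀ {g h i j} → toℕ i ≡ 1 → toℕ j ≡ 1 → g ≢ h → Edge (g , i) (h , j)
    e22 : ∀ {g h i j} → toℕ i ≡ 2 → toℕ j ≡ 2 → g ≢ h → Edge (g , i) (h , j)
    eii : ∀ {g h i j} → 4 ≤ toℕ i → toℕ j ≡ toℕ i → h ≡ gen n ⊕ g → Edge (g , i) (h , j)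
    e02 : ∀ {g h i j} → toℕ i ≡ 0 → toℕ j ≡ 2 → g ≢ h → Edge (g , i) (h , j)
    e23 : ∀ {g h i j} → toℕ i ≡ 2 → toℕ j ≡ 3 → g ≡ h → Edge (g , i) (h , j)
    e3l : ∀ {g h i j} → toℕ i ≡ 3 → toℕ j ≡ m ∸ 1 → g ≢ h → Edge (g , i) (h , j)
    e14 : ∀ {g h i j} → toℕ i ≡ 1 → toℕ j ≡ 4 → g ≢ h → Edge (g , i) (h , j)
    ell : ∀ {g h i j} → 4 ≤ toℕ i → toℕ i ≤ m ∸ 2 → toℕ j ≡ suc (toℕ i) → g ≢ h
          → Edge (g , i) (h , j)
    e03 : ∀ {g h i j} → toℕ i ≡ 0 → toℕ j ≡ 3 → Edge (g , i) (h , j)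
    e01 : ∀ {g h i j} → toℕ i ≡ 0 → toℕ j ≡ 1 → h ≡ g ⊕ gen n → Edge (g , i) (h , j)
    e12 : ∀ {g h i j} → toℕ i ≡ 1 → toℕ j ≡ 2 → h ≡ g ⊕ δ → Edge (g , i) (h , j)

  Adj : V → V → Set
  Adj u v = Edge u v ⊎ Edge v u

  IsAutΔ : (V → V) → Set
  IsAutΔ f = Bijective _≡_ _≡_ f × (∀ u v → Adj u v ⇔ Adj (f u) (f v))

  act : Fin n → V → V
  act g (y , i) = (y ⊕ g , i)

module _ {k : ℕ} (A : Fin k → Fin k → Bool) where

  IsSimple : Set
  IsSimple = (∀ u v → A u v ≡ A v u) × (∀ v → A v v ≡ false)

  IsRegular : Set
  IsRegular = Σ ℕ λ d → ∀ v → Fin d ↔ Σ (Fin k) (λ w → A v w ≡ true)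

  IsAut : (Fin k → Fin k) → Set
  IsAut f = Bijective _≡_ _≡_ f × (∀ u v → A (f u) (f v) ≡ A u v)

-- The graph A (on Fin k) is an m-GRR of the cyclic group ℤ/nℤ: it is a
-- regular simple graph, and there is a group isomorphism φ from ℤ/nℤ onto
-- Aut(A) (φ lands in Aut(A), is a homomorphism, injective and surjective)
-- such that Aut(A) acts semiregularly with exactly m orbits
-- (witnessed by representatives r : Fin m → Fin k of pairwise distinct
-- orbits covering all vertices).
IsMGRR : (n m : ℕ) .{{_ : NonZero n}} {k : ℕ} → (Fin k → Fin k → Bool) → Set
IsMGRR n m {k} A =
  IsSimple A × IsRegular A ×
  Σ (Fin n → Fin k → Fin k) λ φ →
      (∀ g → IsAut A (φ g))
    × (∀ g h v → φ (g ⊕ h) v ≡ φ g (φ h v))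
    × (∀ g h → (∀ v → φ g v ≡ φ h v) → g ≡ h)
    × (∀ f → IsAut A f → Σ (Fin n) λ g → ∀ v → f v ≡ φ g v)
    × (∀ g v → φ g v ≡ v → g ≡ idG n)
    × Σ (Fin m → Fin k) λ r →
          (∀ v → Σ (Fin m) λ j → Σ (Fin n) λ g → v ≡ φ g (r j))
        × (∀ j j' g → r j ≡ φ g (r j') → j ≡ j')

HasMGRR : (n m : ℕ) .{{_ : NonZero n}} → Set
HasMGRR n m = Σ ℕ λ k → Σ (Fin k → Fin k → Bool) λ A → IsMGRR n m A

module Submission where

open import Defs
open import Data.Nat using (ℕ; zero; suc; _+_; _*_; _∸_; _≤_; _<_; NonZero; _%_; z≤n; s≤s; _≡ᵇ_; _<ᵇ_; _≤?_; >-nonZero⁻¹)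
import Data.Nat as ℕ
open import Data.Nat.Properties hiding (_≟_)
open import Data.Nat.DivMod
open import Data.Nat.GCD using (gcd; gcd-zeroˡ; module Bézout)
open import Data.Nat.Coprimality using (gcd≡1⇒coprime; coprime-Bézout)
open import Data.Nat.Tactic.RingSolver using (solve-∀)
open import Data.Fin using (Fin; toℕ; _≟_; fromℕ<; combine; remQuot)
open import Data.Fin.Properties using (toℕ-injective; toℕ<n; toℕ-fromℕ<; combine-remQuot; remQuot-combine; +↔⊎)
open import Data.Product using (Σ; _×_; _,_; proj₁; proj₂; ∃; uncurry)
open import Data.Sum using (_⊎_; inj₁; inj₂; [_,_]′)
open import Data.Bool using (Bool; true; false; T; not)
import Data.Bool as Bool
open import Data.Empty using (⊥; ⊥-elim)
open import Function.Bundles using (_↔_; _⇔_; mk↔ₛ′; mk⇔; Equivalence)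
open import Function.Definitions using (Bijective)
open import Function.Properties.Inverse using (↔-trans)
open import Relation.Binary.PropositionalEquality
  using (_≡_; _≢_; refl; sym; trans; cong; cong₂; subst; subst₂; module ≡-Reasoning)
open import Relation.Nullary using (¬_; Dec; yes; no)
open import Relation.Nullary.Decidable using (map′; _×-dec_; _⊎-dec_; ¬?; isYes)
open import Axiom.UniquenessOfIdentityProofs using (module Decidable⇒UIP)

-- CyclicGroup, Generator: the group laws on Fin n, and (Bézout) a residue
--   coprime to n generates ℤ/nℤ; so s = x x^δ = (1 + δ) mod n generates G.
-- Regularity: every neighbourhood is two blocks, each with one vertex
--   replaced by a special one, so Δ is 2n-regular.
-- Rigidity: the edges in no triangle are exactly the edges at blocks 0 and
--   3, and private neighbours separate block 0 from block 3, so every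
--   automorphism fixes the blocks 0–3.  On block 0 it is a map F commuting
--   with s, hence a translation; this propagates to blocks 1–3 and, by
--   induction, along the chain 4, …, m-1.
-- Encoded, GRR: Δ as a Bool matrix on Fin (n · m) is the required m-GRR.

-- Two distinct numerals cannot both equal the same number.  The side
-- condition is decided by evaluation, so `c≢ p q` closes every "wrong
-- block" case of the neighbourhood analyses below.
c≢ : ∀ {x a b : ℕ} → x ≡ a → x ≡ b → {T (not (a ≡ᵇ b))} → ⊥
c≢ {a = a} refl refl {t} = go a t
  where
  go : ∀ a → T (not (a ≡ᵇ a)) → ⊥
  go zero ()
  go (suc a) t = go a t

≥≢ : ∀ {x a b : ℕ} → b ≤ x → x ≡ a → {T (a <ᵇ b)} → ⊥
≥≢ {a = a} {b} p refl {t} = <⇒≱ (<ᵇ⇒< a b t) p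

module CyclicGroup (n : ℕ) .{{_ : NonZero n}} where

  0ᴳ : Fin n
  0ᴳ = idG n

  toℕ-mod : ∀ a → toℕ (a mod n) ≡ a % n
  toℕ-mod a = toℕ-fromℕ< (m%n<n a n)

  toℕ-⊕ : ∀ (a b : Fin n) → toℕ (a ⊕ b) ≡ (toℕ a + toℕ b) % n
  toℕ-⊕ a b = toℕ-mod (toℕ a + toℕ b)

  0%n≡0 : 0 % n ≡ 0
  0%n≡0 = m<n⇒m%n≡m (>-nonZero⁻¹ n)

  toℕ-0ᴳ : toℕ 0ᴳ ≡ 0
  toℕ-0ᴳ = trans (toℕ-mod 0) 0%n≡0

  toℕ%n : (a : Fin n) → toℕ a % n ≡ toℕ a
  toℕ%n a = m<n⇒m%n≡m (toℕ<n a)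

  %-absorbˡ : ∀ a b → (a % n + b) % n ≡ (a + b) % n
  %-absorbˡ a b = begin
    (a % n + b) % n         ≡⟨ %-distribˡ-+ (a % n) b n ⟩
    (a % n % n + b % n) % n ≡⟨ cong (λ t → (t + b % n) % n) (m%n%n≡m%n a n) ⟩
    (a % n + b % n) % n     ≡⟨ %-distribˡ-+ a b n ⟨
    (a + b) % n             ∎
    where open ≡-Reasoning

  %-absorbʳ : ∀ a b → (a + b % n) % n ≡ (a + b) % n
  %-absorbʳ a b = begin
    (a + b % n) % n ≡⟨ cong (_% n) (+-comm a (b % n)) ⟩
    (b % n + a) % n ≡⟨ %-absorbˡ b a ⟩
    (b + a) % n     ≡⟨ cong (_% n) (+-comm b a) ⟩
    (a + b) % n     ∎
    where open ≡-Reasoning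

  ⊕-comm : ∀ (a b : Fin n) → a ⊕ b ≡ b ⊕ a
  ⊕-comm a b = cong (_mod n) (+-comm (toℕ a) (toℕ b))

  ⊕-assoc : ∀ (a b c : Fin n) → (a ⊕ b) ⊕ c ≡ a ⊕ (b ⊕ c)
  ⊕-assoc a b c = toℕ-injective (begin
    toℕ ((a ⊕ b) ⊕ c)                   ≡⟨ toℕ-⊕ (a ⊕ b) c ⟩
    (toℕ (a ⊕ b) + toℕ c) % n           ≡⟨ cong (λ t → (t + toℕ c) % n) (toℕ-⊕ a b) ⟩
    ((toℕ a + toℕ b) % n + toℕ c) % n   ≡⟨ %-absorbˡ (toℕ a + toℕ b) (toℕ c) ⟩
    (toℕ a + toℕ b + toℕ c) % n         ≡⟨ cong (_% n) (+-assoc (toℕ a) (toℕ b) (toℕ c)) ⟩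
    (toℕ a + (toℕ b + toℕ c)) % n       ≡⟨ %-absorbʳ (toℕ a) (toℕ b + toℕ c) ⟨
    (toℕ a + (toℕ b + toℕ c) % n) % n   ≡⟨ cong (λ t → (toℕ a + t) % n) (toℕ-⊕ b c) ⟨
    (toℕ a + toℕ (b ⊕ c)) % n           ≡⟨ toℕ-⊕ a (b ⊕ c) ⟨
    toℕ (a ⊕ (b ⊕ c))                   ∎)
    where open ≡-Reasoning

  ⊕-identityˡ : ∀ a → 0ᴳ ⊕ a ≡ a
  ⊕-identityˡ a = toℕ-injective (begin
    toℕ (0ᴳ ⊕ a)               ≡⟨ toℕ-⊕ 0ᴳ a ⟩
    (toℕ 0ᴳ + toℕ a) % n       ≡⟨ cong (λ t → (t + toℕ a) % n) toℕ-0ᴳ ⟩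
    toℕ a % n                  ≡⟨ toℕ%n a ⟩
    toℕ a                      ∎)
    where open ≡-Reasoning

  ⊕-identityʳ : ∀ a → a ⊕ 0ᴳ ≡ a
  ⊕-identityʳ a = trans (⊕-comm a 0ᴳ) (⊕-identityˡ a)

  infix 30 ⊖_
  ⊖_ : Fin n → Fin n
  ⊖ a = (n ∸ toℕ a) mod n

  ⊕-inverseʳ : ∀ a → a ⊕ ⊖ a ≡ 0ᴳ
  ⊕-inverseʳ a = toℕ-injective (begin
    toℕ (a ⊕ ⊖ a)                  ≡⟨ toℕ-⊕ a (⊖ a) ⟩
    (toℕ a + toℕ (⊖ a)) % n        ≡⟨ cong (λ t → (toℕ a + t) % n) (toℕ-mod (n ∸ toℕ a)) ⟩
    (toℕ a + (n ∸ toℕ a) % n) % n  ≡⟨ %-absorbʳ (toℕ a) (n ∸ toℕ a) ⟩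
    (toℕ a + (n ∸ toℕ a)) % n      ≡⟨ cong (_% n) (m+[n∸m]≡n (<⇒≤ (toℕ<n a))) ⟩
    n % n                          ≡⟨ n%n≡0 n ⟩
    0                              ≡⟨ toℕ-0ᴳ ⟨
    toℕ 0ᴳ                         ∎)
    where open ≡-Reasoning

  ⊕-inverseˡ : ∀ a → ⊖ a ⊕ a ≡ 0ᴳ
  ⊕-inverseˡ a = trans (⊕-comm (⊖ a) a) (⊕-inverseʳ a)

  ⊕⊖-cancel : ∀ a c → (a ⊕ c) ⊕ ⊖ c ≡ a
  ⊕⊖-cancel a c = begin
    (a ⊕ c) ⊕ ⊖ c ≡⟨ ⊕-assoc a c (⊖ c) ⟩
    a ⊕ (c ⊕ ⊖ c) ≡⟨ cong (a ⊕_) (⊕-inverseʳ c) ⟩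
    a ⊕ 0ᴳ        ≡⟨ ⊕-identityʳ a ⟩
    a             ∎
    where open ≡-Reasoning

  ⊖⊕-cancel : ∀ a c → (a ⊕ ⊖ c) ⊕ c ≡ a
  ⊖⊕-cancel a c = begin
    (a ⊕ ⊖ c) ⊕ c ≡⟨ ⊕-assoc a (⊖ c) c ⟩
    a ⊕ (⊖ c ⊕ c) ≡⟨ cong (a ⊕_) (⊕-inverseˡ c) ⟩
    a ⊕ 0ᴳ        ≡⟨ ⊕-identityʳ a ⟩
    a             ∎
    where open ≡-Reasoning

  ⊕-cancelʳ : ∀ {a b} c → a ⊕ c ≡ b ⊕ c → a ≡ b
  ⊕-cancelʳ {a} {b} c p = begin
    a             ≡⟨ ⊕⊖-cancel a c ⟨
    (a ⊕ c) ⊕ ⊖ c ≡⟨ cong (_⊕ ⊖ c) p ⟩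
    (b ⊕ c) ⊕ ⊖ c ≡⟨ ⊕⊖-cancel b c ⟩
    b             ∎
    where open ≡-Reasoning

  ⊕-cancelˡ : ∀ {a b} c → c ⊕ a ≡ c ⊕ b → a ≡ b
  ⊕-cancelˡ {a} {b} c p = ⊕-cancelʳ c (trans (⊕-comm a c) (trans p (⊕-comm c b)))

  ⊕-rightComm : ∀ a b c → (a ⊕ b) ⊕ c ≡ (a ⊕ c) ⊕ b
  ⊕-rightComm a b c = begin
    (a ⊕ b) ⊕ c ≡⟨ ⊕-assoc a b c ⟩
    a ⊕ (b ⊕ c) ≡⟨ cong (a ⊕_) (⊕-comm b c) ⟩
    a ⊕ (c ⊕ b) ≡⟨ ⊕-assoc a c b ⟨
    (a ⊕ c) ⊕ b ∎
    where open ≡-Reasoning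

  ⊕-moves : ∀ a b → b ≢ 0ᴳ → a ⊕ b ≢ a
  ⊕-moves a b b≢0 p = b≢0 (⊕-cancelˡ a (trans p (sym (⊕-identityʳ a))))

  infixl 30 _·_
  _·_ : ℕ → Fin n → Fin n
  zero  · b = 0ᴳ
  suc k · b = k · b ⊕ b

  toℕ-· : ∀ k b → toℕ (k · b) ≡ (k * toℕ b) % n
  toℕ-· zero b = trans toℕ-0ᴳ (sym 0%n≡0)
  toℕ-· (suc k) b = begin
    toℕ (k · b ⊕ b)                 ≡⟨ toℕ-⊕ (k · b) b ⟩
    (toℕ (k · b) + toℕ b) % n       ≡⟨ cong (λ t → (t + toℕ b) % n) (toℕ-· k b) ⟩
    ((k * toℕ b) % n + toℕ b) % n   ≡⟨ %-absorbˡ (k * toℕ b) (toℕ b) ⟩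
    (k * toℕ b + toℕ b) % n         ≡⟨ cong (_% n) (+-comm (k * toℕ b) (toℕ b)) ⟩
    (toℕ b + k * toℕ b) % n         ∎
    where open ≡-Reasoning

  ·-0ᴳ : ∀ k → k · 0ᴳ ≡ 0ᴳ
  ·-0ᴳ zero = refl
  ·-0ᴳ (suc k) = trans (cong (_⊕ 0ᴳ) (·-0ᴳ k)) (⊕-identityʳ 0ᴳ)

  inverse-mod : ∀ a → gcd a n ≡ 1 → Σ ℕ λ k → (k * a) % n ≡ 1 % n
  inverse-mod a cop with coprime-Bézout (gcd≡1⇒coprime cop)
  ... | Bézout.+- x y eq = x , (begin
    (x * a) % n     ≡⟨ cong (_% n) eq ⟨
    (1 + y * n) % n ≡⟨ [m+kn]%n≡m%n 1 y n ⟩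
    1 % n           ∎)
    where open ≡-Reasoning
  ... | Bézout.-+ x y eq = (n ∸ 1) * x , (begin
    ((n ∸ 1) * x * a) % n                  ≡⟨ [m+kn]%n≡m%n _ y n ⟨
    ((n ∸ 1) * x * a + y * n) % n          ≡⟨ cong (λ t → ((n ∸ 1) * x * a + t) % n) eq ⟨
    ((n ∸ 1) * x * a + (1 + x * a)) % n    ≡⟨ cong (_% n) (regroup (n ∸ 1) x a) ⟩
    (1 + x * a * suc (n ∸ 1)) % n          ≡⟨ cong (λ t → (1 + x * a * t) % n) (suc-pred n) ⟩
    (1 + x * a * n) % n                    ≡⟨ [m+kn]%n≡m%n 1 (x * a) n ⟩
    1 % n                                  ∎)
    where
    open ≡-Reasoning
    regroup : ∀ p x a → p * x * a + (1 + x * a) ≡ 1 + x * a * suc p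
    regroup = solve-∀

  mod-generates : ∀ a → gcd a n ≡ 1 → ∀ g → Σ ℕ λ k → k · (a mod n) ≡ g
  mod-generates a cop g with inverse-mod a cop
  ... | k , ka≡1 = toℕ g * k , toℕ-injective (begin
    toℕ ((toℕ g * k) · (a mod n))            ≡⟨ toℕ-· (toℕ g * k) (a mod n) ⟩
    (toℕ g * k * toℕ (a mod n)) % n          ≡⟨ cong (λ t → (toℕ g * k * t) % n) (toℕ-mod a) ⟩
    (toℕ g * k * (a % n)) % n                ≡⟨ %-distribˡ-* (toℕ g * k) (a % n) n ⟩
    ((toℕ g * k) % n * (a % n % n)) % n      ≡⟨ cong (λ t → ((toℕ g * k) % n * t) % n) (m%n%n≡m%n a n) ⟩
    ((toℕ g * k) % n * (a % n)) % n          ≡⟨ %-distribˡ-* (toℕ g * k) a n ⟨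
    (toℕ g * k * a) % n                      ≡⟨ cong (_% n) (*-assoc (toℕ g) k a) ⟩
    (toℕ g * (k * a)) % n                    ≡⟨ %-distribˡ-* (toℕ g) (k * a) n ⟩
    (toℕ g % n * ((k * a) % n)) % n          ≡⟨ cong (λ t → (toℕ g % n * t) % n) ka≡1 ⟩
    (toℕ g % n * (1 % n)) % n                ≡⟨ %-distribˡ-* (toℕ g) 1 n ⟨
    (toℕ g * 1) % n                          ≡⟨ cong (_% n) (*-identityʳ (toℕ g)) ⟩
    toℕ g % n                                ≡⟨ toℕ%n g ⟩
    toℕ g                                    ∎)
    where open ≡-Reasoning

module Generator (n : ℕ) .{{_ : NonZero n}} (n≥3 : 3 ≤ n) where
  open CyclicGroup n

  toℕ-gen : toℕ (gen n) ≡ 1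
  toℕ-gen = trans (toℕ-mod 1) (m<n⇒m%n≡m (≤-trans (s≤s (s≤s z≤n)) n≥3))

  gen⁻¹ : Fin n
  gen⁻¹ = ⊖ gen n

  gen2 : Fin n
  gen2 = gen n ⊕ gen n

  toℕ-gen2 : toℕ gen2 ≡ 2
  toℕ-gen2 = begin
    toℕ (gen n ⊕ gen n)              ≡⟨ toℕ-⊕ (gen n) (gen n) ⟩
    (toℕ (gen n) + toℕ (gen n)) % n  ≡⟨ cong₂ (λ a b → (a + b) % n) toℕ-gen toℕ-gen ⟩
    2 % n                            ≡⟨ m<n⇒m%n≡m n≥3 ⟩
    2                                ∎
    where open ≡-Reasoning

  gen≢0ᴳ : gen n ≢ 0ᴳ
  gen≢0ᴳ p = c≢ toℕ-gen (trans (cong toℕ p) toℕ-0ᴳ)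

  gen2≢0ᴳ : gen2 ≢ 0ᴳ
  gen2≢0ᴳ p = c≢ toℕ-gen2 (trans (cong toℕ p) toℕ-0ᴳ)

  gen2≢gen : gen2 ≢ gen n
  gen2≢gen p = c≢ toℕ-gen2 (trans (cong toℕ p) toℕ-gen)

  ⊕gen≢ : ∀ g → g ⊕ gen n ≢ g
  ⊕gen≢ g = ⊕-moves g (gen n) gen≢0ᴳ

  -- x⁻¹ ⊕ g is the neighbour of g on the other side of the x-cycle
  gen⁻¹-back : ∀ g → gen n ⊕ (gen⁻¹ ⊕ g) ≡ g
  gen⁻¹-back g = begin
    gen n ⊕ (gen⁻¹ ⊕ g)  ≡⟨ ⊕-assoc (gen n) gen⁻¹ g ⟨
    (gen n ⊕ gen⁻¹) ⊕ g  ≡⟨ cong (_⊕ g) (⊕-inverseʳ (gen n)) ⟩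
    0ᴳ ⊕ g               ≡⟨ ⊕-identityˡ g ⟩
    g                    ∎
    where open ≡-Reasoning

  -- the two x-cycle neighbours of g are distinct, as x ⊕ x ≠ 0ᴳ
  gen⊕≢gen⁻¹⊕ : ∀ g → gen n ⊕ g ≢ gen⁻¹ ⊕ g
  gen⊕≢gen⁻¹⊕ g p = gen2≢0ᴳ (trans (cong (gen n ⊕_) (⊕-cancelʳ g p)) (⊕-inverseʳ (gen n)))

  third : (a b : Fin n) → Σ (Fin n) λ k → (k ≢ a) × (k ≢ b)
  third a b with 0ᴳ ≟ a | 0ᴳ ≟ b | gen n ≟ a | gen n ≟ b
  ... | no p  | no q  | _     | _     = 0ᴳ , p , q
  ... | _     | _     | no r  | no s  = gen n , r , s
  ... | yes p | _     | yes r | _     = ⊥-elim (gen≢0ᴳ (trans r (sym p)))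
  ... | _     | yes q | _     | yes s = ⊥-elim (gen≢0ᴳ (trans s (sym q)))
  ... | yes p | _     | _     | yes s =
    gen2 , (λ t → gen2≢0ᴳ (trans t (sym p))) , (λ t → gen2≢gen (trans t (sym s)))
  ... | _     | yes q | yes r | _     =
    gen2 , (λ t → gen2≢gen (trans t (sym r))) , (λ t → gen2≢0ᴳ (trans t (sym q)))

  gen⊕≡ : ∀ δ → gen n ⊕ δ ≡ (1 + toℕ δ) mod n
  gen⊕≡ δ = cong (λ t → (t + toℕ δ) mod n) toℕ-gen

blockView : ∀ k → k ≡ 0 ⊎ k ≡ 1 ⊎ k ≡ 2 ⊎ k ≡ 3 ⊎ 4 ≤ k
blockView 0 = inj₁ refl
blockView 1 = inj₂ (inj₁ refl)
blockView 2 = inj₂ (inj₂ (inj₁ refl))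
blockView 3 = inj₂ (inj₂ (inj₂ (inj₁ refl)))
blockView (suc (suc (suc (suc k)))) = inj₂ (inj₂ (inj₂ (inj₂ (s≤s (s≤s (s≤s (s≤s z≤n)))))))

module Graph (n m : ℕ) .{{_ : NonZero n}} (n≥3 : 3 ≤ n) (m≥5 : 5 ≤ m) (δ : Fin n) where
  open CyclicGroup n
  open Generator n n≥3
  open Delta n m δ

  L : ℕ
  L = m ∸ 1

  4≤L : 4 ≤ L
  4≤L = ∸-monoˡ-≤ 1 m≥5

  4≤-L : ∀ {k} → k ≡ L → 4 ≤ k
  4≤-L q = subst (4 ≤_) (sym q) 4≤L

  L≰m∸2 : ¬ (L ≤ m ∸ 2)
  L≰m∸2 = go m m≥5
    where
    go : ∀ k → 5 ≤ k → ¬ (k ∸ 1 ≤ k ∸ 2)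
    go (suc (suc k)) _ le = 1+n≰n le
    go (suc zero) (s≤s ()) le

  suc<m : ∀ {a} → suc a < m → a ≤ m ∸ 2
  suc<m {a} q = go m q
    where
    go : ∀ k → suc a < k → a ≤ k ∸ 2
    go (suc (suc k)) (s≤s (s≤s q)) = q

  I0 I1 I2 I3 I4 IL : Fin m
  I0 = fromℕ< {0} (≤-<-trans z≤n m≥5)
  I1 = fromℕ< {1} (≤-<-trans (s≤s z≤n) m≥5)
  I2 = fromℕ< {2} (≤-<-trans (s≤s (s≤s z≤n)) m≥5)
  I3 = fromℕ< {3} (≤-<-trans (s≤s (s≤s (s≤s z≤n))) m≥5)
  I4 = fromℕ< {4} m≥5
  IL = fromℕ< {L} (∸-monoʳ-< {m} {1} {0} (s≤s z≤n) (≤-trans (s≤s z≤n) m≥5))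

  toℕ-I0 : toℕ I0 ≡ 0
  toℕ-I0 = toℕ-fromℕ< _
  toℕ-I1 : toℕ I1 ≡ 1
  toℕ-I1 = toℕ-fromℕ< _
  toℕ-I2 : toℕ I2 ≡ 2
  toℕ-I2 = toℕ-fromℕ< _
  toℕ-I3 : toℕ I3 ≡ 3
  toℕ-I3 = toℕ-fromℕ< _
  toℕ-I4 : toℕ I4 ≡ 4
  toℕ-I4 = toℕ-fromℕ< _
  toℕ-IL : toℕ IL ≡ L
  toℕ-IL = toℕ-fromℕ< _

  block-eq : ∀ {j k : Fin m} {a} → toℕ j ≡ a → toℕ k ≡ a → j ≡ k
  block-eq p q = toℕ-injective (trans p (sym q))

  adj-sym : ∀ {u v} → Adj u v → Adj v u
  adj-sym (inj₁ x) = inj₂ x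
  adj-sym (inj₂ x) = inj₁ x

  edge-act : ∀ c {g i h j} → Edge (g , i) (h , j) → Edge (g ⊕ c , i) (h ⊕ c , j)
  edge-act c (e11 p q r) = e11 p q (λ s → r (⊕-cancelʳ c s))
  edge-act c (e22 p q r) = e22 p q (λ s → r (⊕-cancelʳ c s))
  edge-act c {g} (eii p q r) = eii p q (trans (cong (_⊕ c) r) (⊕-assoc (gen n) g c))
  edge-act c (e02 p q r) = e02 p q (λ s → r (⊕-cancelʳ c s))
  edge-act c (e23 p q r) = e23 p q (cong (_⊕ c) r)
  edge-act c (e3l p q r) = e3l p q (λ s → r (⊕-cancelʳ c s))
  edge-act c (e14 p q r) = e14 p q (λ s → r (⊕-cancelʳ c s))
  edge-act c (ell p q r s) = ell p q r (λ t → s (⊕-cancelʳ c t))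
  edge-act c (e03 p q) = e03 p q
  edge-act c {g} (e01 p q r) = e01 p q (trans (cong (_⊕ c) r) (⊕-rightComm g (gen n) c))
  edge-act c {g} (e12 p q r) = e12 p q (trans (cong (_⊕ c) r) (⊕-rightComm g δ c))

  adj-act : ∀ c u v → Adj u v → Adj (act c u) (act c v)
  adj-act c (g , i) (h , j) (inj₁ x) = inj₁ (edge-act c x)
  adj-act c (g , i) (h , j) (inj₂ x) = inj₂ (edge-act c x)

  act-⊖ : ∀ c u → act (⊖ c) (act c u) ≡ u
  act-⊖ c (g , i) = cong (_, i) (⊕⊖-cancel g c)

  ⊖-act : ∀ c u → act c (act (⊖ c) u) ≡ u
  ⊖-act c (g , i) = cong (_, i) (⊖⊕-cancel g c)

  act-injective : ∀ c {u v} → act c u ≡ act c v → u ≡ v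
  act-injective c {u} {v} p = trans (sym (act-⊖ c u)) (trans (cong (act (⊖ c)) p) (act-⊖ c v))

  adj-act⁻ : ∀ c u v → Adj (act c u) (act c v) → Adj u v
  adj-act⁻ c u v a = subst₂ Adj (act-⊖ c u) (act-⊖ c v) (adj-act (⊖ c) (act c u) (act c v) a)

  isAut-act : ∀ c → IsAutΔ (act c)
  isAut-act c = (act-injective c , λ v → act (⊖ c) v , λ { refl → ⊖-act c v }) ,
                λ u v → mk⇔ (adj-act c u v) (adj-act⁻ c u v)

  act-faithful : ∀ g h → (∀ v → act g v ≡ act h v) → g ≡ h
  act-faithful g h p = ⊕-cancelˡ 0ᴳ (cong proj₁ (p (0ᴳ , I0)))

  act-⊕ : ∀ g h v → act (g ⊕ h) v ≡ act g (act h v)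
  act-⊕ g h (y , i) = cong (_, i) (begin
    y ⊕ (g ⊕ h)  ≡⟨ cong (y ⊕_) (⊕-comm g h) ⟩
    y ⊕ (h ⊕ g)  ≡⟨ ⊕-assoc y h g ⟨
    (y ⊕ h) ⊕ g  ∎)
    where open ≡-Reasoning

  act-free : ∀ g v → act g v ≡ v → g ≡ 0ᴳ
  act-free g (y , i) p = ⊕-cancelˡ y (trans (cong proj₁ p) (sym (⊕-identityʳ y)))

  Nbr0 : Fin n → Fin n → Fin m → Set
  Nbr0 g h j = (toℕ j ≡ 1 × h ≡ g ⊕ gen n) ⊎ (toℕ j ≡ 2 × g ≢ h) ⊎ toℕ j ≡ 3

  nbrs0 : ∀ {g i h j} → toℕ i ≡ 0 → Adj (g , i) (h , j) → Nbr0 g h j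
  nbrs0 z (inj₁ (e11 p q r)) = ⊥-elim (c≢ z p)
  nbrs0 z (inj₁ (e22 p q r)) = ⊥-elim (c≢ z p)
  nbrs0 z (inj₁ (eii p q r)) = ⊥-elim (≥≢ p z)
  nbrs0 z (inj₁ (e02 p q r)) = inj₂ (inj₁ (q , r))
  nbrs0 z (inj₁ (e23 p q r)) = ⊥-elim (c≢ z p)
  nbrs0 z (inj₁ (e3l p q r)) = ⊥-elim (c≢ z p)
  nbrs0 z (inj₁ (e14 p q r)) = ⊥-elim (c≢ z p)
  nbrs0 z (inj₁ (ell p q r s)) = ⊥-elim (≥≢ p z)
  nbrs0 z (inj₁ (e03 p q)) = inj₂ (inj₂ q)
  nbrs0 z (inj₁ (e01 p q r)) = inj₁ (q , r)
  nbrs0 z (inj₁ (e12 p q r)) = ⊥-elim (c≢ z p)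
  nbrs0 z (inj₂ (e11 p q r)) = ⊥-elim (c≢ z q)
  nbrs0 z (inj₂ (e22 p q r)) = ⊥-elim (c≢ z q)
  nbrs0 z (inj₂ (eii p q r)) = ⊥-elim (≥≢ p (trans (sym q) z))
  nbrs0 z (inj₂ (e02 p q r)) = ⊥-elim (c≢ z q)
  nbrs0 z (inj₂ (e23 p q r)) = ⊥-elim (c≢ z q)
  nbrs0 z (inj₂ (e3l p q r)) = ⊥-elim (≥≢ 4≤L (trans (sym q) z))
  nbrs0 z (inj₂ (e14 p q r)) = ⊥-elim (c≢ z q)
  nbrs0 z (inj₂ (ell p q r s)) = ⊥-elim (≥≢ (s≤s p) (trans (sym r) z))
  nbrs0 z (inj₂ (e03 p q)) = ⊥-elim (c≢ z q)
  nbrs0 z (inj₂ (e01 p q r)) = ⊥-elim (c≢ z q)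
  nbrs0 z (inj₂ (e12 p q r)) = ⊥-elim (c≢ z q)

  Nbr1 : Fin n → Fin n → Fin m → Set
  Nbr1 g h j = (toℕ j ≡ 0 × g ≡ h ⊕ gen n) ⊎ (toℕ j ≡ 1 × g ≢ h)
             ⊎ (toℕ j ≡ 2 × h ≡ g ⊕ δ) ⊎ (toℕ j ≡ 4 × g ≢ h)

  nbrs1 : ∀ {g i h j} → toℕ i ≡ 1 → Adj (g , i) (h , j) → Nbr1 g h j
  nbrs1 z (inj₁ (e11 p q r)) = inj₂ (inj₁ (q , r))
  nbrs1 z (inj₁ (e22 p q r)) = ⊥-elim (c≢ z p)
  nbrs1 z (inj₁ (eii p q r)) = ⊥-elim (≥≢ p z)
  nbrs1 z (inj₁ (e02 p q r)) = ⊥-elim (c≢ z p)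
  nbrs1 z (inj₁ (e23 p q r)) = ⊥-elim (c≢ z p)
  nbrs1 z (inj₁ (e3l p q r)) = ⊥-elim (c≢ z p)
  nbrs1 z (inj₁ (e14 p q r)) = inj₂ (inj₂ (inj₂ (q , r)))
  nbrs1 z (inj₁ (ell p q r s)) = ⊥-elim (≥≢ p z)
  nbrs1 z (inj₁ (e03 p q)) = ⊥-elim (c≢ z p)
  nbrs1 z (inj₁ (e01 p q r)) = ⊥-elim (c≢ z p)
  nbrs1 z (inj₁ (e12 p q r)) = inj₂ (inj₂ (inj₁ (q , r)))
  nbrs1 z (inj₂ (e11 p q r)) = inj₂ (inj₁ (p , λ s → r (sym s)))
  nbrs1 z (inj₂ (e22 p q r)) = ⊥-elim (c≢ z q)
  nbrs1 z (inj₂ (eii p q r)) = ⊥-elim (≥≢ p (trans (sym q) z))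
  nbrs1 z (inj₂ (e02 p q r)) = ⊥-elim (c≢ z q)
  nbrs1 z (inj₂ (e23 p q r)) = ⊥-elim (c≢ z q)
  nbrs1 z (inj₂ (e3l p q r)) = ⊥-elim (≥≢ 4≤L (trans (sym q) z))
  nbrs1 z (inj₂ (e14 p q r)) = ⊥-elim (c≢ z q)
  nbrs1 z (inj₂ (ell p q r s)) = ⊥-elim (≥≢ (s≤s p) (trans (sym r) z))
  nbrs1 z (inj₂ (e03 p q)) = ⊥-elim (c≢ z q)
  nbrs1 z (inj₂ (e01 p q r)) = inj₁ (p , r)
  nbrs1 z (inj₂ (e12 p q r)) = ⊥-elim (c≢ z q)

  Nbr2 : Fin n → Fin n → Fin m → Set
  Nbr2 g h j = (toℕ j ≡ 0 × g ≢ h) ⊎ (toℕ j ≡ 1 × g ≡ h ⊕ δ)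
             ⊎ (toℕ j ≡ 2 × g ≢ h) ⊎ (toℕ j ≡ 3 × g ≡ h)

  nbrs2 : ∀ {g i h j} → toℕ i ≡ 2 → Adj (g , i) (h , j) → Nbr2 g h j
  nbrs2 z (inj₁ (e11 p q r)) = ⊥-elim (c≢ z p)
  nbrs2 z (inj₁ (e22 p q r)) = inj₂ (inj₂ (inj₁ (q , r)))
  nbrs2 z (inj₁ (eii p q r)) = ⊥-elim (≥≢ p z)
  nbrs2 z (inj₁ (e02 p q r)) = ⊥-elim (c≢ z p)
  nbrs2 z (inj₁ (e23 p q r)) = inj₂ (inj₂ (inj₂ (q , r)))
  nbrs2 z (inj₁ (e3l p q r)) = ⊥-elim (c≢ z p)
  nbrs2 z (inj₁ (e14 p q r)) = ⊥-elim (c≢ z p)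
  nbrs2 z (inj₁ (ell p q r s)) = ⊥-elim (≥≢ p z)
  nbrs2 z (inj₁ (e03 p q)) = ⊥-elim (c≢ z p)
  nbrs2 z (inj₁ (e01 p q r)) = ⊥-elim (c≢ z p)
  nbrs2 z (inj₁ (e12 p q r)) = ⊥-elim (c≢ z p)
  nbrs2 z (inj₂ (e11 p q r)) = ⊥-elim (c≢ z q)
  nbrs2 z (inj₂ (e22 p q r)) = inj₂ (inj₂ (inj₁ (p , λ s → r (sym s))))
  nbrs2 z (inj₂ (eii p q r)) = ⊥-elim (≥≢ p (trans (sym q) z))
  nbrs2 z (inj₂ (e02 p q r)) = inj₁ (p , λ s → r (sym s))
  nbrs2 z (inj₂ (e23 p q r)) = ⊥-elim (c≢ z q)
  nbrs2 z (inj₂ (e3l p q r)) = ⊥-elim (≥≢ 4≤L (trans (sym q) z))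
  nbrs2 z (inj₂ (e14 p q r)) = ⊥-elim (c≢ z q)
  nbrs2 z (inj₂ (ell p q r s)) = ⊥-elim (≥≢ (s≤s p) (trans (sym r) z))
  nbrs2 z (inj₂ (e03 p q)) = ⊥-elim (c≢ z q)
  nbrs2 z (inj₂ (e01 p q r)) = ⊥-elim (c≢ z q)
  nbrs2 z (inj₂ (e12 p q r)) = inj₂ (inj₁ (p , r))

  Nbr3 : Fin n → Fin n → Fin m → Set
  Nbr3 g h j = (toℕ j ≡ 2 × g ≡ h) ⊎ (toℕ j ≡ L × g ≢ h) ⊎ toℕ j ≡ 0

  nbrs3 : ∀ {g i h j} → toℕ i ≡ 3 → Adj (g , i) (h , j) → Nbr3 g h j
  nbrs3 z (inj₁ (e11 p q r)) = ⊥-elim (c≢ z p)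
  nbrs3 z (inj₁ (e22 p q r)) = ⊥-elim (c≢ z p)
  nbrs3 z (inj₁ (eii p q r)) = ⊥-elim (≥≢ p z)
  nbrs3 z (inj₁ (e02 p q r)) = ⊥-elim (c≢ z p)
  nbrs3 z (inj₁ (e23 p q r)) = ⊥-elim (c≢ z p)
  nbrs3 z (inj₁ (e3l p q r)) = inj₂ (inj₁ (q , r))
  nbrs3 z (inj₁ (e14 p q r)) = ⊥-elim (c≢ z p)
  nbrs3 z (inj₁ (ell p q r s)) = ⊥-elim (≥≢ p z)
  nbrs3 z (inj₁ (e03 p q)) = ⊥-elim (c≢ z p)
  nbrs3 z (inj₁ (e01 p q r)) = ⊥-elim (c≢ z p)
  nbrs3 z (inj₁ (e12 p q r)) = ⊥-elim (c≢ z p)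
  nbrs3 z (inj₂ (e11 p q r)) = ⊥-elim (c≢ z q)
  nbrs3 z (inj₂ (e22 p q r)) = ⊥-elim (c≢ z q)
  nbrs3 z (inj₂ (eii p q r)) = ⊥-elim (≥≢ p (trans (sym q) z))
  nbrs3 z (inj₂ (e02 p q r)) = ⊥-elim (c≢ z q)
  nbrs3 z (inj₂ (e23 p q r)) = inj₁ (p , sym r)
  nbrs3 z (inj₂ (e3l p q r)) = ⊥-elim (≥≢ 4≤L (trans (sym q) z))
  nbrs3 z (inj₂ (e14 p q r)) = ⊥-elim (c≢ z q)
  nbrs3 z (inj₂ (ell p q r s)) = ⊥-elim (≥≢ (s≤s p) (trans (sym r) z))
  nbrs3 z (inj₂ (e03 p q)) = inj₂ (inj₂ p)
  nbrs3 z (inj₂ (e01 p q r)) = ⊥-elim (c≢ z q)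
  nbrs3 z (inj₂ (e12 p q r)) = ⊥-elim (c≢ z q)

  CycleNbr : Fin n → Fin n → Set
  CycleNbr g h = (h ≡ gen n ⊕ g) ⊎ (g ≡ gen n ⊕ h)

  Nbrℓ : Fin n → Fin m → Fin n → Fin m → Set
  Nbrℓ g i h j = (toℕ j ≡ toℕ i × CycleNbr g h)
       ⊎ ((toℕ i ≡ 4 × toℕ j ≡ 1 × g ≢ h) ⊎ (toℕ i ≡ suc (toℕ j) × 4 ≤ toℕ j × g ≢ h))
       ⊎ ((toℕ i ≡ L × toℕ j ≡ 3 × g ≢ h) ⊎ (toℕ j ≡ suc (toℕ i) × toℕ i ≤ m ∸ 2 × g ≢ h))

  nbrsℓ : ∀ {g i h j} → 4 ≤ toℕ i → Adj (g , i) (h , j) → Nbrℓ g i h j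
  nbrsℓ z (inj₁ (e11 p q r)) = ⊥-elim (≥≢ z p)
  nbrsℓ z (inj₁ (e22 p q r)) = ⊥-elim (≥≢ z p)
  nbrsℓ z (inj₁ (eii p q r)) = inj₁ (q , inj₁ r)
  nbrsℓ z (inj₁ (e02 p q r)) = ⊥-elim (≥≢ z p)
  nbrsℓ z (inj₁ (e23 p q r)) = ⊥-elim (≥≢ z p)
  nbrsℓ z (inj₁ (e3l p q r)) = ⊥-elim (≥≢ z p)
  nbrsℓ z (inj₁ (e14 p q r)) = ⊥-elim (≥≢ z p)
  nbrsℓ z (inj₁ (ell p q r s)) = inj₂ (inj₂ (inj₂ (r , q , s)))
  nbrsℓ z (inj₁ (e03 p q)) = ⊥-elim (≥≢ z p)
  nbrsℓ z (inj₁ (e01 p q r)) = ⊥-elim (≥≢ z p)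
  nbrsℓ z (inj₁ (e12 p q r)) = ⊥-elim (≥≢ z p)
  nbrsℓ z (inj₂ (e11 p q r)) = ⊥-elim (≥≢ z q)
  nbrsℓ z (inj₂ (e22 p q r)) = ⊥-elim (≥≢ z q)
  nbrsℓ z (inj₂ (eii p q r)) = inj₁ (sym q , inj₂ r)
  nbrsℓ z (inj₂ (e02 p q r)) = ⊥-elim (≥≢ z q)
  nbrsℓ z (inj₂ (e23 p q r)) = ⊥-elim (≥≢ z q)
  nbrsℓ z (inj₂ (e3l p q r)) = inj₂ (inj₂ (inj₁ (q , p , λ s → r (sym s))))
  nbrsℓ z (inj₂ (e14 p q r)) = inj₂ (inj₁ (inj₁ (q , p , λ s → r (sym s))))
  nbrsℓ z (inj₂ (ell p q r s)) = inj₂ (inj₁ (inj₂ (r , p , λ t → s (sym t))))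
  nbrsℓ z (inj₂ (e03 p q)) = ⊥-elim (≥≢ z q)
  nbrsℓ z (inj₂ (e01 p q r)) = ⊥-elim (≥≢ z q)
  nbrsℓ z (inj₂ (e12 p q r)) = ⊥-elim (≥≢ z q)

  -- The chain blocks form the path 1 — 4 — 5 — ⋯ — (m-1) — 3, joined by
  -- "g ~ g' iff g ≠ g'" edges.
  record PrevBlock (i : Fin m) : Set where
    field
      prev        : Fin m
      prev<       : toℕ prev < toℕ i
      prev-edge   : ∀ {k g} → k ≢ g → Edge (k , prev) (g , i)
      prev-nbrs   : ∀ {k h j} → Adj (k , prev) (h , j) → toℕ j < toℕ i ⊎ (j ≡ i × k ≢ h)
      prev-unique : ∀ {y} → (toℕ i ≡ 4 × y ≡ 1) ⊎ (toℕ i ≡ suc y × 4 ≤ y) → toℕ prev ≡ y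
      prev-kind   : toℕ prev ≡ 1 ⊎ 4 ≤ toℕ prev

  prevBlock : ∀ i → 4 ≤ toℕ i → PrevBlock i
  prevBlock i i≥4 with toℕ i ℕ.≟ 4
  ... | yes i≡4 = record
    { prev = I1 ; prev< = subst₂ _<_ (sym toℕ-I1) (sym i≡4) (s≤s (s≤s z≤n))
    ; prev-edge = e14 toℕ-I1 i≡4 ; prev-nbrs = nbrs ; prev-unique = unique ; prev-kind = inj₁ toℕ-I1 }
    where
    unique : ∀ {y} → (toℕ i ≡ 4 × y ≡ 1) ⊎ (toℕ i ≡ suc y × 4 ≤ y) → toℕ I1 ≡ y
    unique (inj₁ (_ , q)) = trans toℕ-I1 (sym q)
    unique (inj₂ (q , y≥4)) = ⊥-elim (≥≢ y≥4 (suc-injective (trans (sym q) i≡4)))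
    nbrs : ∀ {k h j} → Adj (k , I1) (h , j) → toℕ j < toℕ i ⊎ (j ≡ i × k ≢ h)
    nbrs a with nbrs1 toℕ-I1 a
    ... | inj₁ (q , _) = inj₁ (subst₂ _<_ (sym q) (sym i≡4) (s≤s z≤n))
    ... | inj₂ (inj₁ (q , _)) = inj₁ (subst₂ _<_ (sym q) (sym i≡4) (s≤s (s≤s z≤n)))
    ... | inj₂ (inj₂ (inj₁ (q , _))) = inj₁ (subst₂ _<_ (sym q) (sym i≡4) (s≤s (s≤s (s≤s z≤n))))
    ... | inj₂ (inj₂ (inj₂ (q , r))) = inj₂ (toℕ-injective (trans q (sym i≡4)) , r)
  ... | no i≢4 = record
    { prev = p ; prev< = p<i ; prev-edge = ell p≥4 p≤m∸2 i≡1+p ; prev-nbrs = nbrs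
    ; prev-unique = unique ; prev-kind = inj₂ p≥4 }
    where
    i≥5 : 5 ≤ toℕ i
    i≥5 = ≤∧≢⇒< i≥4 (λ x → i≢4 (sym x))
    p : Fin m
    p = fromℕ< (≤-<-trans (m∸n≤m (toℕ i) 1) (toℕ<n i))
    i≡1+p : toℕ i ≡ suc (toℕ p)
    i≡1+p = trans (sym (m+[n∸m]≡n (≤-trans (s≤s z≤n) i≥4))) (cong suc (sym (toℕ-fromℕ< _)))
    p<i : toℕ p < toℕ i
    p<i = subst (suc (toℕ p) ≤_) (sym i≡1+p) ≤-refl
    p≥4 : 4 ≤ toℕ p
    p≥4 = ≤-pred (subst (5 ≤_) i≡1+p i≥5)
    p≤m∸2 : toℕ p ≤ m ∸ 2
    p≤m∸2 = suc<m (subst (_< m) i≡1+p (toℕ<n i))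
    nbrs : ∀ {k h j} → Adj (k , p) (h , j) → toℕ j < toℕ i ⊎ (j ≡ i × k ≢ h)
    nbrs a with nbrsℓ p≥4 a
    ... | inj₁ (q , _) = inj₁ (subst (_< toℕ i) (sym q) p<i)
    ... | inj₂ (inj₁ (inj₁ (_ , q , _))) = inj₁ (subst (_< toℕ i) (sym q) (≤-trans (s≤s (s≤s z≤n)) i≥4))
    ... | inj₂ (inj₁ (inj₂ (q , _ , _))) = inj₁ (<-trans (subst (toℕ _ <_) (sym q) ≤-refl) p<i)
    ... | inj₂ (inj₂ (inj₁ (_ , q , _))) = inj₁ (subst (_< toℕ i) (sym q) i≥4)
    ... | inj₂ (inj₂ (inj₂ (q , _ , r))) = inj₂ (toℕ-injective (trans q (sym i≡1+p)) , r)
    unique : ∀ {y} → (toℕ i ≡ 4 × y ≡ 1) ⊎ (toℕ i ≡ suc y × 4 ≤ y) → toℕ p ≡ y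
    unique (inj₁ (q , _)) = ⊥-elim (i≢4 q)
    unique (inj₂ (q , _)) = suc-injective (trans (sym i≡1+p) q)

  record NextBlock (i : Fin m) : Set where
    field
      next        : Fin m
      next-kind   : toℕ next ≡ 3 ⊎ toℕ i < toℕ next
      next-adj    : ∀ {k g} → k ≢ g → Adj (g , i) (k , next)
      next-unique : ∀ {y} → (toℕ i ≡ L × y ≡ 3) ⊎ (y ≡ suc (toℕ i) × toℕ i ≤ m ∸ 2) → toℕ next ≡ y

  nextBlock : ∀ i → 4 ≤ toℕ i → NextBlock i
  nextBlock i i≥4 with toℕ i ℕ.≟ L
  ... | yes i≡L = record
    { next = I3 ; next-kind = inj₁ toℕ-I3 ; next-adj = λ r → inj₂ (e3l toℕ-I3 i≡L r)
    ; next-unique = unique }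
    where
    unique : ∀ {y} → (toℕ i ≡ L × y ≡ 3) ⊎ (y ≡ suc (toℕ i) × toℕ i ≤ m ∸ 2) → toℕ I3 ≡ y
    unique (inj₁ (_ , q)) = trans toℕ-I3 (sym q)
    unique (inj₂ (_ , le)) = ⊥-elim (L≰m∸2 (subst (_≤ m ∸ 2) i≡L le))
  ... | no i≢L = record
    { next = q ; next-kind = inj₂ (subst (toℕ i <_) (sym q≡1+i) ≤-refl)
    ; next-adj = λ r → inj₁ (ell i≥4 i≤m∸2 q≡1+i (λ s → r (sym s))) ; next-unique = unique }
    where
    1+i<m : suc (toℕ i) < m
    1+i<m = ≤∧≢⇒< (toℕ<n i) (λ s → i≢L (cong ℕ.pred s))
    q : Fin m
    q = fromℕ< 1+i<m
    q≡1+i : toℕ q ≡ suc (toℕ i)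
    q≡1+i = toℕ-fromℕ< _
    i≤m∸2 : toℕ i ≤ m ∸ 2
    i≤m∸2 = suc<m 1+i<m
    unique : ∀ {y} → (toℕ i ≡ L × y ≡ 3) ⊎ (y ≡ suc (toℕ i) × toℕ i ≤ m ∸ 2) → toℕ q ≡ y
    unique (inj₁ (e , _)) = ⊥-elim (i≢L e)
    unique (inj₂ (e , _)) = trans q≡1+i (sym e)

  cycleNbrAvoiding : ∀ {i} → 4 ≤ toℕ i → ∀ g h → Σ (Fin n) λ k → Adj (g , i) (k , i) × k ≢ h
  cycleNbrAvoiding {i} i≥4 g h with gen n ⊕ g ≟ h
  ... | no r = gen n ⊕ g , inj₁ (eii i≥4 refl refl) , r
  ... | yes r = gen⁻¹ ⊕ g , inj₂ (eii i≥4 refl (sym (gen⁻¹-back g))) ,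
                λ q → gen⊕≢gen⁻¹⊕ g (trans r (sym q))

  nbrs0⁻¹ : ∀ {g i h j} → toℕ i ≡ 0 → Nbr0 g h j → Adj (g , i) (h , j)
  nbrs0⁻¹ z (inj₁ (q , r)) = inj₁ (e01 z q r)
  nbrs0⁻¹ z (inj₂ (inj₁ (q , r))) = inj₁ (e02 z q r)
  nbrs0⁻¹ z (inj₂ (inj₂ q)) = inj₁ (e03 z q)

  nbrs1⁻¹ : ∀ {g i h j} → toℕ i ≡ 1 → Nbr1 g h j → Adj (g , i) (h , j)
  nbrs1⁻¹ z (inj₁ (q , r)) = inj₂ (e01 q z r)
  nbrs1⁻¹ z (inj₂ (inj₁ (q , r))) = inj₁ (e11 z q r)
  nbrs1⁻¹ z (inj₂ (inj₂ (inj₁ (q , r)))) = inj₁ (e12 z q r)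
  nbrs1⁻¹ z (inj₂ (inj₂ (inj₂ (q , r)))) = inj₁ (e14 z q r)

  nbrs2⁻¹ : ∀ {g i h j} → toℕ i ≡ 2 → Nbr2 g h j → Adj (g , i) (h , j)
  nbrs2⁻¹ z (inj₁ (q , r)) = inj₂ (e02 q z (λ x → r (sym x)))
  nbrs2⁻¹ z (inj₂ (inj₁ (q , r))) = inj₂ (e12 q z r)
  nbrs2⁻¹ z (inj₂ (inj₂ (inj₁ (q , r)))) = inj₁ (e22 z q r)
  nbrs2⁻¹ z (inj₂ (inj₂ (inj₂ (q , r)))) = inj₁ (e23 z q r)

  nbrs3⁻¹ : ∀ {g i h j} → toℕ i ≡ 3 → Nbr3 g h j → Adj (g , i) (h , j)
  nbrs3⁻¹ z (inj₁ (q , r)) = inj₂ (e23 q z (sym r))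
  nbrs3⁻¹ z (inj₂ (inj₁ (q , r))) = inj₁ (e3l z q r)
  nbrs3⁻¹ z (inj₂ (inj₂ q)) = inj₂ (e03 q z)

  nbrsℓ⁻¹ : ∀ {g i h j} → 4 ≤ toℕ i → Nbrℓ g i h j → Adj (g , i) (h , j)
  nbrsℓ⁻¹ i≥4 (inj₁ (q , inj₁ r)) = inj₁ (eii i≥4 q r)
  nbrsℓ⁻¹ i≥4 (inj₁ (q , inj₂ r)) = inj₂ (eii (subst (4 ≤_) (sym q) i≥4) (sym q) r)
  nbrsℓ⁻¹ i≥4 (inj₂ (inj₁ (inj₁ (q , p , r)))) = inj₂ (e14 p q (λ x → r (sym x)))
  nbrsℓ⁻¹ {i = i} i≥4 (inj₂ (inj₁ (inj₂ (q , p , r)))) =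
    inj₂ (ell p (suc<m (subst (_< m) q (toℕ<n i))) q (λ x → r (sym x)))
  nbrsℓ⁻¹ i≥4 (inj₂ (inj₂ (inj₁ (q , p , r)))) = inj₂ (e3l p q (λ x → r (sym x)))
  nbrsℓ⁻¹ i≥4 (inj₂ (inj₂ (inj₂ (q , p , r)))) = inj₁ (ell i≥4 p q r)

  decAdj : ∀ u v → Dec (Adj u v)
  decAdj (g , i) (h , j) with blockView (toℕ i)
  ... | inj₁ z = map′ (nbrs0⁻¹ z) (nbrs0 z)
        ((toℕ j ℕ.≟ 1 ×-dec h ≟ g ⊕ gen n) ⊎-dec (toℕ j ℕ.≟ 2 ×-dec ¬? (g ≟ h)) ⊎-dec (toℕ j ℕ.≟ 3))
  ... | inj₂ (inj₁ z) = map′ (nbrs1⁻¹ z) (nbrs1 z)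
        ((toℕ j ℕ.≟ 0 ×-dec g ≟ h ⊕ gen n) ⊎-dec (toℕ j ℕ.≟ 1 ×-dec ¬? (g ≟ h))
         ⊎-dec (toℕ j ℕ.≟ 2 ×-dec h ≟ g ⊕ δ) ⊎-dec (toℕ j ℕ.≟ 4 ×-dec ¬? (g ≟ h)))
  ... | inj₂ (inj₂ (inj₁ z)) = map′ (nbrs2⁻¹ z) (nbrs2 z)
        ((toℕ j ℕ.≟ 0 ×-dec ¬? (g ≟ h)) ⊎-dec (toℕ j ℕ.≟ 1 ×-dec g ≟ h ⊕ δ)
         ⊎-dec (toℕ j ℕ.≟ 2 ×-dec ¬? (g ≟ h)) ⊎-dec (toℕ j ℕ.≟ 3 ×-dec g ≟ h))
  ... | inj₂ (inj₂ (inj₂ (inj₁ z))) = map′ (nbrs3⁻¹ z) (nbrs3 z)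
        ((toℕ j ℕ.≟ 2 ×-dec g ≟ h) ⊎-dec (toℕ j ℕ.≟ L ×-dec ¬? (g ≟ h)) ⊎-dec (toℕ j ℕ.≟ 0))
  ... | inj₂ (inj₂ (inj₂ (inj₂ i≥4))) = map′ (nbrsℓ⁻¹ i≥4) (nbrsℓ i≥4)
        ((toℕ j ℕ.≟ toℕ i ×-dec (h ≟ gen n ⊕ g ⊎-dec g ≟ gen n ⊕ h))
         ⊎-dec ((toℕ i ℕ.≟ 4 ×-dec toℕ j ℕ.≟ 1 ×-dec ¬? (g ≟ h))
                ⊎-dec (toℕ i ℕ.≟ suc (toℕ j) ×-dec 4 ≤? toℕ j ×-dec ¬? (g ≟ h)))
         ⊎-dec ((toℕ i ℕ.≟ L ×-dec toℕ j ℕ.≟ 3 ×-dec ¬? (g ≟ h))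
                ⊎-dec (toℕ j ℕ.≟ suc (toℕ i) ×-dec toℕ i ≤? m ∸ 2 ×-dec ¬? (g ≟ h))))

  irreflexive : ∀ v → ¬ Adj v v
  irreflexive (g , i) (inj₁ x) = noLoop x
    where
    noLoop : ∀ {g i} → ¬ Edge (g , i) (g , i)
    noLoop (e11 p q r) = r refl
    noLoop (e22 p q r) = r refl
    noLoop {g} (eii p q r) = ⊕gen≢ g (trans (⊕-comm g (gen n)) (sym r))
    noLoop (e02 p q r) = c≢ p q
    noLoop (e23 p q r) = c≢ p q
    noLoop (e3l p q r) = ≥≢ (4≤-L q) p
    noLoop (e14 p q r) = c≢ p q
    noLoop (ell p q r s) = s refl
    noLoop (e03 p q) = c≢ p q
    noLoop (e01 p q r) = c≢ p q
    noLoop (e12 p q r) = c≢ p q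
  irreflexive v (inj₂ x) = irreflexive v (inj₁ x)

[,]-injective : {A B C : Set} {f : A → C} {g : B → C}
              → (∀ {a a'} → f a ≡ f a' → a ≡ a') → (∀ {b b'} → g b ≡ g b' → b ≡ b')
              → (∀ a b → f a ≢ g b) → ∀ {x y} → [ f , g ]′ x ≡ [ f , g ]′ y → x ≡ y
[,]-injective f-inj g-inj disj {inj₁ a} {inj₁ a'} p = cong inj₁ (f-inj p)
[,]-injective f-inj g-inj disj {inj₁ a} {inj₂ b'} p = ⊥-elim (disj a b' p)
[,]-injective f-inj g-inj disj {inj₂ b} {inj₁ a'} p = ⊥-elim (disj a' b (sym p))
[,]-injective f-inj g-inj disj {inj₂ b} {inj₂ b'} p = cong inj₂ (g-inj p)

module Regularity (n m : ℕ) .{{_ : NonZero n}} (n≥3 : 3 ≤ n) (m≥5 : 5 ≤ m) (δ : Fin n) where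
  open CyclicGroup n
  open Generator n n≥3
  open Delta n m δ
  open Graph n m n≥3 m≥5 δ

  record NbrEnumeration (v : V) : Set where
    field
      enum       : Fin n ⊎ Fin n → V
      injective  : ∀ {x y} → enum x ≡ enum y → x ≡ y
      sound      : ∀ x → Adj v (enum x)
      complete   : ∀ w → Adj v w → Σ (Fin n ⊎ Fin n) λ x → enum x ≡ w

  fst≢ : ∀ {h g : Fin n} {X Y : Fin m} → h ≢ g → (h , X) ≢ (g , Y)
  fst≢ ne p = ne (cong proj₁ p)

  snd≢ : ∀ {h g : Fin n} {X Y : Fin m} → X ≢ Y → (h , X) ≢ (g , Y)
  snd≢ ne p = ne (cong proj₂ p)

  block≢ : ∀ {a b} (X Y : Fin m) → toℕ X ≡ a → toℕ Y ≡ b → {T (not (a ≡ᵇ b))} → X ≢ Y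
  block≢ X Y p q {t} r = c≢ p (trans (cong toℕ r) q) {t}

  IL≢ : ∀ {b} (X : Fin m) → toℕ X ≡ b → b < 4 → IL ≢ X
  IL≢ X p b<4 r = <⇒≱ b<4 (subst (4 ≤_) (trans (sym toℕ-IL) (trans (cong toℕ r) p)) 4≤L)

  sym≢ : ∀ {A : Set} {x y : A} → x ≢ y → y ≢ x
  sym≢ ne p = ne (sym p)

  module Patch (g : Fin n) (s : V) (X : Fin m) where

    patch : Fin n → V
    patch h with h ≟ g
    ... | yes _ = s
    ... | no _ = (h , X)

    patch-view : ∀ h → (h ≡ g × patch h ≡ s) ⊎ (h ≢ g × patch h ≡ (h , X))
    patch-view h with h ≟ g
    ... | yes p = inj₁ (p , refl)
    ... | no p = inj₂ (p , refl)

    patch-at : patch g ≡ s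
    patch-at with patch-view g
    ... | inj₁ (_ , q) = q
    ... | inj₂ (ne , _) = ⊥-elim (ne refl)

    patch-off : ∀ h → h ≢ g → patch h ≡ (h , X)
    patch-off h ne with patch-view h
    ... | inj₁ (p , _) = ⊥-elim (ne p)
    ... | inj₂ (_ , q) = q

    patch-injective : (∀ h → h ≢ g → (h , X) ≢ s) → ∀ {h h'} → patch h ≡ patch h' → h ≡ h'
    patch-injective s∉X {h} {h'} p with patch-view h | patch-view h'
    ... | inj₁ (a , _)  | inj₁ (b , _)  = trans a (sym b)
    ... | inj₁ (_ , qa) | inj₂ (b , qb) = ⊥-elim (s∉X h' b (trans (sym qb) (trans (sym p) qa)))
    ... | inj₂ (a , qa) | inj₁ (_ , qb) = ⊥-elim (s∉X h a (trans (sym qa) (trans p qb)))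
    ... | inj₂ (_ , qa) | inj₂ (_ , qb) = cong proj₁ (trans (sym qa) (trans p qb))

    patch-adj : ∀ {v} → Adj v s → (∀ h → h ≢ g → Adj v (h , X)) → ∀ h → Adj v (patch h)
    patch-adj {v} adj-s adj-X h with patch-view h
    ... | inj₁ (_ , q) = subst (Adj v) (sym q) adj-s
    ... | inj₂ (ne , q) = subst (Adj v) (sym q) (adj-X h ne)

  module TwoPatches (v : V) (g : Fin n) (X₁ X₂ : Fin m) (s₁ s₂ : V)
      (X₁≢X₂ : X₁ ≢ X₂) (s₁≢s₂ : s₁ ≢ s₂)
      (s₁∉X₁ : ∀ h → h ≢ g → (h , X₁) ≢ s₁) (s₁∉X₂ : ∀ h → h ≢ g → (h , X₂) ≢ s₁)
      (s₂∉X₁ : ∀ h → h ≢ g → (h , X₁) ≢ s₂) (s₂∉X₂ : ∀ h → h ≢ g → (h , X₂) ≢ s₂)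
      (adj-s₁ : Adj v s₁) (adj-X₁ : ∀ h → h ≢ g → Adj v (h , X₁))
      (adj-s₂ : Adj v s₂) (adj-X₂ : ∀ h → h ≢ g → Adj v (h , X₂)) where

    module P₁ = Patch g s₁ X₁
    module P₂ = Patch g s₂ X₂

    data Listed : V → Set where
      is-s₁ : ∀ {w} → s₁ ≡ w → Listed w
      is-s₂ : ∀ {w} → s₂ ≡ w → Listed w
      in-X₁ : ∀ {h j} → h ≢ g → j ≡ X₁ → Listed (h , j)
      in-X₂ : ∀ {h j} → h ≢ g → j ≡ X₂ → Listed (h , j)

    disjoint : ∀ h h' → P₁.patch h ≢ P₂.patch h'
    disjoint h h' p with P₁.patch-view h | P₂.patch-view h'
    ... | inj₁ (_ , qa) | inj₁ (_ , qb) = s₁≢s₂ (trans (sym qa) (trans p qb))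
    ... | inj₁ (_ , qa) | inj₂ (b , qb) = s₁∉X₂ h' b (trans (sym qb) (trans (sym p) qa))
    ... | inj₂ (a , qa) | inj₁ (_ , qb) = s₂∉X₁ h a (trans (sym qa) (trans p qb))
    ... | inj₂ (_ , qa) | inj₂ (_ , qb) = X₁≢X₂ (cong proj₂ (trans (sym qa) (trans p qb)))

    enumeration : (∀ w → Adj v w → Listed w) → NbrEnumeration v
    enumeration classify = record
      { enum = [ P₁.patch , P₂.patch ]′
      ; injective = [,]-injective (P₁.patch-injective s₁∉X₁) (P₂.patch-injective s₂∉X₂) disjoint
      ; sound = λ { (inj₁ h) → P₁.patch-adj adj-s₁ adj-X₁ h ; (inj₂ h) → P₂.patch-adj adj-s₂ adj-X₂ h }
      ; complete = λ w a → locate (classify w a) }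
      where
      locate : ∀ {w} → Listed w → Σ (Fin n ⊎ Fin n) λ x → [ P₁.patch , P₂.patch ]′ x ≡ w
      locate (is-s₁ refl) = inj₁ g , P₁.patch-at
      locate (is-s₂ refl) = inj₂ g , P₂.patch-at
      locate (in-X₁ {h} ne refl) = inj₁ h , P₁.patch-off h ne
      locate (in-X₂ {h} ne refl) = inj₂ h , P₂.patch-off h ne

  nbrEnum0 : ∀ g i → toℕ i ≡ 0 → NbrEnumeration (g , i)
  nbrEnum0 g i z = enumeration classify
    where
    open TwoPatches (g , i) g I3 I2 (g , I3) (g ⊕ gen n , I1)
      (block≢ I3 I2 toℕ-I3 toℕ-I2) (snd≢ (block≢ I3 I1 toℕ-I3 toℕ-I1))
      (λ h ne → fst≢ ne) (λ h _ → snd≢ (block≢ I2 I3 toℕ-I2 toℕ-I3))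
      (λ h _ → snd≢ (block≢ I3 I1 toℕ-I3 toℕ-I1)) (λ h _ → snd≢ (block≢ I2 I1 toℕ-I2 toℕ-I1))
      (inj₁ (e03 z toℕ-I3)) (λ h _ → inj₁ (e03 z toℕ-I3))
      (inj₁ (e01 z toℕ-I1 refl)) (λ h ne → inj₁ (e02 z toℕ-I2 (sym≢ ne)))
    classify : ∀ w → Adj (g , i) w → Listed w
    classify (h , j) a with nbrs0 z a
    ... | inj₁ (q , r) = is-s₂ (cong₂ _,_ (sym r) (sym (block-eq q toℕ-I1)))
    ... | inj₂ (inj₁ (q , r)) = in-X₂ (sym≢ r) (block-eq q toℕ-I2)
    ... | inj₂ (inj₂ q) with h ≟ g
    ...   | yes p = is-s₁ (cong₂ _,_ (sym p) (sym (block-eq q toℕ-I3)))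
    ...   | no p = in-X₁ p (block-eq q toℕ-I3)

  nbrEnum1 : ∀ g i → toℕ i ≡ 1 → NbrEnumeration (g , i)
  nbrEnum1 g i z = enumeration classify
    where
    open TwoPatches (g , i) g I1 I4 (g ⊕ gen⁻¹ , I0) (g ⊕ δ , I2)
      (block≢ I1 I4 toℕ-I1 toℕ-I4) (snd≢ (block≢ I0 I2 toℕ-I0 toℕ-I2))
      (λ h _ → snd≢ (block≢ I1 I0 toℕ-I1 toℕ-I0)) (λ h _ → snd≢ (block≢ I4 I0 toℕ-I4 toℕ-I0))
      (λ h _ → snd≢ (block≢ I1 I2 toℕ-I1 toℕ-I2)) (λ h _ → snd≢ (block≢ I4 I2 toℕ-I4 toℕ-I2))
      (inj₂ (e01 toℕ-I0 z (sym (⊖⊕-cancel g (gen n))))) (λ h ne → inj₁ (e11 z toℕ-I1 (sym≢ ne)))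
      (inj₁ (e12 z toℕ-I2 refl)) (λ h ne → inj₁ (e14 z toℕ-I4 (sym≢ ne)))
    classify : ∀ w → Adj (g , i) w → Listed w
    classify (h , j) a with nbrs1 z a
    ... | inj₁ (q , r) =
      is-s₁ (cong₂ _,_ (trans (cong (_⊕ gen⁻¹) r) (⊕⊖-cancel h (gen n))) (sym (block-eq q toℕ-I0)))
    ... | inj₂ (inj₁ (q , r)) = in-X₁ (sym≢ r) (block-eq q toℕ-I1)
    ... | inj₂ (inj₂ (inj₁ (q , r))) = is-s₂ (cong₂ _,_ (sym r) (sym (block-eq q toℕ-I2)))
    ... | inj₂ (inj₂ (inj₂ (q , r))) = in-X₂ (sym≢ r) (block-eq q toℕ-I4)

  nbrEnum2 : ∀ g i → toℕ i ≡ 2 → NbrEnumeration (g , i)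
  nbrEnum2 g i z = enumeration classify
    where
    open TwoPatches (g , i) g I2 I0 (g , I3) (g ⊕ ⊖ δ , I1)
      (block≢ I2 I0 toℕ-I2 toℕ-I0) (snd≢ (block≢ I3 I1 toℕ-I3 toℕ-I1))
      (λ h _ → snd≢ (block≢ I2 I3 toℕ-I2 toℕ-I3)) (λ h _ → snd≢ (block≢ I0 I3 toℕ-I0 toℕ-I3))
      (λ h _ → snd≢ (block≢ I2 I1 toℕ-I2 toℕ-I1)) (λ h _ → snd≢ (block≢ I0 I1 toℕ-I0 toℕ-I1))
      (inj₁ (e23 z toℕ-I3 refl)) (λ h ne → inj₁ (e22 z toℕ-I2 (sym≢ ne)))
      (inj₂ (e12 toℕ-I1 z (sym (⊖⊕-cancel g δ)))) (λ h ne → inj₂ (e02 toℕ-I0 z ne))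
    classify : ∀ w → Adj (g , i) w → Listed w
    classify (h , j) a with nbrs2 z a
    ... | inj₁ (q , r) = in-X₂ (sym≢ r) (block-eq q toℕ-I0)
    ... | inj₂ (inj₁ (q , r)) =
      is-s₂ (cong₂ _,_ (trans (cong (_⊕ ⊖ δ) r) (⊕⊖-cancel h δ)) (sym (block-eq q toℕ-I1)))
    ... | inj₂ (inj₂ (inj₁ (q , r))) = in-X₁ (sym≢ r) (block-eq q toℕ-I2)
    ... | inj₂ (inj₂ (inj₂ (q , r))) = is-s₁ (cong₂ _,_ r (sym (block-eq q toℕ-I3)))

  nbrEnum3 : ∀ g i → toℕ i ≡ 3 → NbrEnumeration (g , i)
  nbrEnum3 g i z = enumeration classify
    where
    open TwoPatches (g , i) g I0 IL (g , I0) (g , I2)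
      (sym≢ (IL≢ I0 toℕ-I0 (s≤s z≤n))) (snd≢ (block≢ I0 I2 toℕ-I0 toℕ-I2))
      (λ h ne → fst≢ ne) (λ h _ → snd≢ (IL≢ I0 toℕ-I0 (s≤s z≤n)))
      (λ h _ → snd≢ (block≢ I0 I2 toℕ-I0 toℕ-I2)) (λ h _ → snd≢ (IL≢ I2 toℕ-I2 (s≤s (s≤s (s≤s z≤n)))))
      (inj₂ (e03 toℕ-I0 z)) (λ h _ → inj₂ (e03 toℕ-I0 z))
      (inj₂ (e23 toℕ-I2 z refl)) (λ h ne → inj₁ (e3l z toℕ-IL (sym≢ ne)))
    classify : ∀ w → Adj (g , i) w → Listed w
    classify (h , j) a with nbrs3 z a
    ... | inj₁ (q , r) = is-s₂ (cong₂ _,_ r (sym (block-eq q toℕ-I2)))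
    ... | inj₂ (inj₁ (q , r)) = in-X₂ (sym≢ r) (block-eq q toℕ-IL)
    ... | inj₂ (inj₂ q) with h ≟ g
    ...   | yes p = is-s₁ (cong₂ _,_ (sym p) (sym (block-eq q toℕ-I0)))
    ...   | no p = in-X₁ p (block-eq q toℕ-I0)

  nbrEnumℓ : ∀ g i → 4 ≤ toℕ i → NbrEnumeration (g , i)
  nbrEnumℓ g i i≥4 = enumeration classify
    where
    open PrevBlock (prevBlock i i≥4)
    open NextBlock (nextBlock i i≥4)
    prev≢i : prev ≢ i
    prev≢i r = <-irrefl (cong toℕ r) prev<
    next≢i : next ≢ i
    next≢i r with next-kind
    ... | inj₁ x = ≥≢ i≥4 (trans (cong toℕ (sym r)) x)
    ... | inj₂ x = <-irrefl (cong toℕ (sym r)) x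
    prev≢next : prev ≢ next
    prev≢next r with next-kind | prev-kind
    ... | inj₁ x | inj₁ y = c≢ y (trans (cong toℕ r) x)
    ... | inj₁ x | inj₂ y = ≥≢ y (trans (cong toℕ r) x)
    ... | inj₂ x | _ = <-asym prev< (subst (toℕ i <_) (cong toℕ (sym r)) x)
    open TwoPatches (g , i) g prev next (gen n ⊕ g , i) (gen⁻¹ ⊕ g , i)
      prev≢next (λ r → gen⊕≢gen⁻¹⊕ g (cong proj₁ r))
      (λ h _ → snd≢ prev≢i) (λ h _ → snd≢ next≢i) (λ h _ → snd≢ prev≢i) (λ h _ → snd≢ next≢i)
      (inj₁ (eii i≥4 refl refl)) (λ h ne → inj₂ (prev-edge ne))
      (inj₂ (eii i≥4 refl (sym (gen⁻¹-back g)))) (λ h ne → next-adj ne)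
    gen⁻¹-undo : ∀ h → gen⁻¹ ⊕ (gen n ⊕ h) ≡ h
    gen⁻¹-undo h = trans (sym (⊕-assoc gen⁻¹ (gen n) h))
                         (trans (cong (_⊕ h) (⊕-inverseˡ (gen n))) (⊕-identityˡ h))
    classify : ∀ w → Adj (g , i) w → Listed w
    classify (h , j) a with nbrsℓ i≥4 a
    ... | inj₁ (x , inj₁ r) = is-s₁ (cong₂ _,_ (sym r) (sym (toℕ-injective x)))
    ... | inj₁ (x , inj₂ r) = is-s₂ (cong₂ _,_ (trans (cong (gen⁻¹ ⊕_) r) (gen⁻¹-undo h)) (sym (toℕ-injective x)))
    ... | inj₂ (inj₁ (inj₁ (e , x , r))) = in-X₁ (sym≢ r) (toℕ-injective (sym (prev-unique (inj₁ (e , x)))))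
    ... | inj₂ (inj₁ (inj₂ (e , x , r))) = in-X₁ (sym≢ r) (toℕ-injective (sym (prev-unique (inj₂ (e , x)))))
    ... | inj₂ (inj₂ (inj₁ (e , x , r))) = in-X₂ (sym≢ r) (toℕ-injective (sym (next-unique (inj₁ (e , x)))))
    ... | inj₂ (inj₂ (inj₂ (e , x , r))) = in-X₂ (sym≢ r) (toℕ-injective (sym (next-unique (inj₂ (e , x)))))

  nbrEnumeration : ∀ v → NbrEnumeration v
  nbrEnumeration (g , i) with blockView (toℕ i)
  ... | inj₁ z = nbrEnum0 g i z
  ... | inj₂ (inj₁ z) = nbrEnum1 g i z
  ... | inj₂ (inj₂ (inj₁ z)) = nbrEnum2 g i z
  ... | inj₂ (inj₂ (inj₂ (inj₁ z))) = nbrEnum3 g i z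
  ... | inj₂ (inj₂ (inj₂ (inj₂ z))) = nbrEnumℓ g i z

module Rigidity (n m : ℕ) .{{_ : NonZero n}} (n≥3 : 3 ≤ n) (m≥5 : 5 ≤ m) (δ : Fin n)
                (cop : gcd (1 + toℕ δ) n ≡ 1) where
  open CyclicGroup n
  open Generator n n≥3
  open Delta n m δ
  open Graph n m n≥3 m≥5 δ

  s : Fin n
  s = gen n ⊕ δ

  s-generates : ∀ g → Σ ℕ λ k → k · s ≡ g
  s-generates g with mod-generates (1 + toℕ δ) cop g
  ... | k , p = k , trans (cong (k ·_) (gen⊕≡ δ)) p

  s≢0ᴳ : s ≢ 0ᴳ
  s≢0ᴳ p with s-generates (gen n)
  ... | k , q = gen≢0ᴳ (trans (sym q) (trans (cong (k ·_) p) (·-0ᴳ k)))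

  -- s ≠ 0ᴳ makes h₀ adjacent to (h x x^δ)₂, closing the triangle h₀ (h x)₁ (h x x^δ)₂
  h≢hxs : ∀ h → h ≢ (h ⊕ gen n) ⊕ δ
  h≢hxs h q = s≢0ᴳ (⊕-cancelˡ h (trans (sym (⊕-assoc h (gen n) δ)) (trans (sym q) (sym (⊕-identityʳ h)))))

  -- likewise (h x⁻¹)₀ ~ (h x^δ)₂, closing the triangle (h x⁻¹)₀ h₁ (h x^δ)₂
  hx⁻¹≢hδ : ∀ h → h ⊕ gen⁻¹ ≢ h ⊕ δ
  hx⁻¹≢hδ h q = h≢hxs (h ⊕ gen⁻¹) (trans q (cong (_⊕ δ) (sym (⊖⊕-cancel h (gen n)))))

  Outer : V → Set
  Outer u = toℕ (proj₂ u) ≡ 0 ⊎ toℕ (proj₂ u) ≡ 3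

  CommonNbr : V → V → Set
  CommonNbr u v = Σ V λ w → Adj u w × Adj v w

  TriangleFree : V → V → Set
  TriangleFree u v = Adj u v × (∀ w → Adj u w → Adj v w → ⊥)

  triangle1 : ∀ {g i h j} → toℕ i ≡ 1 → Adj (g , i) (h , j) → CommonNbr (g , i) (h , j)
  triangle1 {g} {i} {h} {j} z a with nbrs1 z a
  ... | inj₁ (q , r) = (g ⊕ δ , I2) , inj₁ (e12 z toℕ-I2 refl) ,
                       inj₁ (e02 q toℕ-I2 (λ x → h≢hxs h (trans x (cong (_⊕ δ) r))))
  ... | inj₂ (inj₁ (q , r)) with third g h
  ...   | k , k≢g , k≢h = (k , I1) , inj₁ (e11 z toℕ-I1 (λ x → k≢g (sym x))) ,
                          inj₁ (e11 q toℕ-I1 (λ x → k≢h (sym x)))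
  triangle1 {g} {i} {h} {j} z a | inj₂ (inj₂ (inj₁ (q , r))) =
    (g ⊕ gen⁻¹ , I0) , inj₂ (e01 toℕ-I0 z (sym (⊖⊕-cancel g (gen n)))) ,
    inj₂ (e02 toℕ-I0 q (λ x → hx⁻¹≢hδ g (trans x r)))
  triangle1 {g} {i} {h} {j} z a | inj₂ (inj₂ (inj₂ (q , r))) with third g h
  ... | k , k≢g , k≢h = (k , I1) , inj₁ (e11 z toℕ-I1 (λ x → k≢g (sym x))) , inj₂ (e14 toℕ-I1 q k≢h)

  triangle2 : ∀ {g i h j} → toℕ i ≡ 2 → Adj (g , i) (h , j) → CommonNbr (g , i) (h , j)
  triangle2 {g} {i} {h} {j} z a with nbrs2 z a
  ... | inj₁ (q , r) = (g , I3) , inj₁ (e23 z toℕ-I3 refl) , inj₁ (e03 q toℕ-I3)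
  ... | inj₂ (inj₁ (q , r)) =
    (h ⊕ gen⁻¹ , I0) , inj₂ (e02 toℕ-I0 z (λ x → hx⁻¹≢hδ h (trans x r))) ,
    inj₂ (e01 toℕ-I0 q (sym (⊖⊕-cancel h (gen n))))
  ... | inj₂ (inj₂ (inj₁ (q , r))) with third g h
  ...   | k , k≢g , k≢h = (k , I2) , inj₁ (e22 z toℕ-I2 (λ x → k≢g (sym x))) ,
                          inj₁ (e22 q toℕ-I2 (λ x → k≢h (sym x)))
  triangle2 {g} {i} {h} {j} z a | inj₂ (inj₂ (inj₂ (q , r))) =
    (g ⊕ gen n , I0) , inj₂ (e02 toℕ-I0 z (⊕gen≢ g)) , inj₂ (e03 toℕ-I0 q)

  triangleℓ : ∀ {g i h j} → 4 ≤ toℕ i → Adj (g , i) (h , j) → CommonNbr (g , i) (h , j)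
  triangleℓ {g} {i} {h} {j} i≥4 a with nbrsℓ i≥4 a
  ... | inj₁ (q , _) with third g h | toℕ-injective {i = j} {j = i} q
  ...   | k , k≢g , k≢h | refl = (k , prev) , inj₂ (prev-edge k≢g) , inj₂ (prev-edge k≢h)
    where open PrevBlock (prevBlock i i≥4)
  triangleℓ {g} {i} {h} {j} i≥4 a | inj₂ (inj₁ (inj₁ (i≡4 , q , r))) with third g h
  ... | k , k≢g , k≢h = (k , I1) , inj₂ (e14 toℕ-I1 i≡4 k≢g) , inj₁ (e11 q toℕ-I1 (λ x → k≢h (sym x)))
  triangleℓ {g} {i} {h} {j} i≥4 a | inj₂ (inj₁ (inj₂ (q , j≥4 , r))) with cycleNbrAvoiding {j} j≥4 h g
  ... | k , hk , k≢g = (k , j) , inj₂ (ell j≥4 (suc<m (subst (_< m) q (toℕ<n i))) q k≢g) , hk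
  triangleℓ {g} {i} {h} {j} i≥4 a | inj₂ (inj₂ (inj₁ (i≡L , q , r))) with cycleNbrAvoiding {i} i≥4 g h
  ... | k , gk , k≢h = (k , i) , gk , inj₁ (e3l q i≡L (λ x → k≢h (sym x)))
  triangleℓ {g} {i} {h} {j} i≥4 a | inj₂ (inj₂ (inj₂ (q , le , r))) with cycleNbrAvoiding {i} i≥4 g h
  ... | k , gk , k≢h = (k , i) , gk , inj₂ (ell i≥4 le q k≢h)

  triangleFree⇒outer : ∀ u v → TriangleFree u v → Outer u
  triangleFree⇒outer (g , i) (h , j) (a , none) with blockView (toℕ i)
  ... | inj₁ z = inj₁ z
  ... | inj₂ (inj₁ z) = ⊥-elim (let (w , x , y) = triangle1 z a in none w x y)
  ... | inj₂ (inj₂ (inj₁ z)) = ⊥-elim (let (w , x , y) = triangle2 z a in none w x y)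
  ... | inj₂ (inj₂ (inj₂ (inj₁ z))) = inj₂ z
  ... | inj₂ (inj₂ (inj₂ (inj₂ z))) = ⊥-elim (let (w , x , y) = triangleℓ z a in none w x y)

  noCommon03 : ∀ {g i i'} → toℕ i ≡ 0 → toℕ i' ≡ 3 → ∀ w → Adj (g , i) w → Adj (g , i') w → ⊥
  noCommon03 z z' (h , j) a₀ a₃ with nbrs0 z a₀ | nbrs3 z' a₃
  ... | inj₁ (q , _) | inj₁ (q' , _) = c≢ q q'
  ... | inj₁ (q , _) | inj₂ (inj₁ (q' , _)) = ≥≢ (4≤-L q') q
  ... | inj₁ (q , _) | inj₂ (inj₂ q') = c≢ q q'
  ... | inj₂ (inj₁ (_ , r)) | inj₁ (_ , r') = r r'
  ... | inj₂ (inj₁ (q , _)) | inj₂ (inj₁ (q' , _)) = ≥≢ (4≤-L q') q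
  ... | inj₂ (inj₁ (q , _)) | inj₂ (inj₂ q') = c≢ q q'
  ... | inj₂ (inj₂ q) | inj₁ (q' , _) = c≢ q q'
  ... | inj₂ (inj₂ q) | inj₂ (inj₁ (q' , _)) = ≥≢ (4≤-L q') q
  ... | inj₂ (inj₂ q) | inj₂ (inj₂ q') = c≢ q q'

  outer⇒triangleFree : ∀ u → Outer u → Σ V λ v → TriangleFree u v
  outer⇒triangleFree (g , i) (inj₁ z) = (g , I3) , inj₁ (e03 z toℕ-I3) , noCommon03 z toℕ-I3
  outer⇒triangleFree (g , i) (inj₂ z) = (g , I0) , inj₂ (e03 toℕ-I0 z) , λ w x y → noCommon03 toℕ-I0 z w y x

  -- u has a private neighbour: a non-outer neighbour w whose only outer
  -- neighbour is u.  This separates block 0 from block 3.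
  HasPrivateNbr : V → Set
  HasPrivateNbr u = Σ V λ w → Adj u w × ¬ Outer w × (∀ z → Outer z → Adj w z → z ≡ u)

  private0 : ∀ {g i} → toℕ i ≡ 0 → HasPrivateNbr (g , i)
  private0 {g} {i} z = (g ⊕ gen n , I1) , inj₁ (e01 z toℕ-I1 refl) , not-outer , only-g₀
    where
    not-outer : ¬ Outer (g ⊕ gen n , I1)
    not-outer (inj₁ x) = c≢ toℕ-I1 x
    not-outer (inj₂ x) = c≢ toℕ-I1 x
    only-g₀ : ∀ w → Outer w → Adj (g ⊕ gen n , I1) w → w ≡ (g , i)
    only-g₀ (h , j) o a with nbrs1 toℕ-I1 a | o
    ... | inj₁ (q , r) | _ = cong₂ _,_ (⊕-cancelʳ (gen n) (sym r)) (toℕ-injective (trans q (sym z)))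
    ... | inj₂ (inj₁ (q , _)) | inj₁ x = ⊥-elim (c≢ q x)
    ... | inj₂ (inj₁ (q , _)) | inj₂ x = ⊥-elim (c≢ q x)
    ... | inj₂ (inj₂ (inj₁ (q , _))) | inj₁ x = ⊥-elim (c≢ q x)
    ... | inj₂ (inj₂ (inj₁ (q , _))) | inj₂ x = ⊥-elim (c≢ q x)
    ... | inj₂ (inj₂ (inj₂ (q , _))) | inj₁ x = ⊥-elim (c≢ q x)
    ... | inj₂ (inj₂ (inj₂ (q , _))) | inj₂ x = ⊥-elim (c≢ q x)

  -- the non-outer neighbours h₂ and h_{m-1} of g₃ have other outer neighbours
  ¬private3 : ∀ {g i} → toℕ i ≡ 3 → ¬ HasPrivateNbr (g , i)
  ¬private3 {g} {i} z ((h , j) , a , not-outer , only) with nbrs3 z a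
  ... | inj₁ (q , r) = c≢ z (trans (sym (cong (λ v → toℕ (proj₂ v)) (only (h ⊕ gen n , I0) (inj₁ toℕ-I0) h₂~)))
                                   toℕ-I0)
    where
    h₂~ : Adj (h , j) (h ⊕ gen n , I0)
    h₂~ = inj₂ (e02 toℕ-I0 q (⊕gen≢ h))
  ... | inj₂ (inj₁ (q , r)) with third g h
  ...   | k , k≢g , k≢h = k≢g (cong proj₁ (only (k , I3) (inj₂ toℕ-I3) (inj₂ (e3l toℕ-I3 q k≢h))))
  ¬private3 {g} {i} z ((h , j) , a , not-outer , only) | inj₂ (inj₂ q) = not-outer (inj₁ q)

  record Automorphism : Set where
    field
      to from   : V → V
      from-to   : ∀ v → from (to v) ≡ v
      to-from   : ∀ v → to (from v) ≡ v
      preserves : ∀ {u v} → Adj u v → Adj (to u) (to v)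
      reflects  : ∀ {u v} → Adj (to u) (to v) → Adj u v
  open Automorphism

  fromIsAut : (f : V → V) → IsAutΔ f → Automorphism
  fromIsAut f ((inj , surj) , adj) = record
    { to = f ; from = λ y → proj₁ (surj y)
    ; from-to = λ v → inj (proj₂ (surj (f v)) refl)
    ; to-from = λ y → proj₂ (surj y) refl
    ; preserves = λ {u} {v} → Equivalence.to (adj u v)
    ; reflects = λ {u} {v} → Equivalence.from (adj u v) }

  inverse : Automorphism → Automorphism
  inverse a = record
    { to = from a ; from = to a ; from-to = to-from a ; to-from = from-to a
    ; preserves = λ {u} {v} x → reflects a (subst₂ Adj (sym (to-from a u)) (sym (to-from a v)) x)
    ; reflects = λ {u} {v} x → subst₂ Adj (to-from a u) (to-from a v) (preserves a x) }

  adj-from : ∀ a {u} w → Adj (to a u) w → Adj u (from a w)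
  adj-from a {u} w x = reflects a (subst (Adj (to a u)) (sym (to-from a w)) x)

  to-injective : ∀ a {u v} → to a u ≡ to a v → u ≡ v
  to-injective a {u} {v} p = trans (sym (from-to a u)) (trans (cong (from a) p) (from-to a v))

  reflected : (P : V → Set) → (∀ a u → P u → P (to a u)) → ∀ a u → P (to a u) → P u
  reflected P preserved a u p = subst P (from-to a u) (preserved (inverse a) (to a u) p)

  triangleFree-preserved : ∀ a {u v} → TriangleFree u v → TriangleFree (to a u) (to a v)
  triangleFree-preserved a (x , none) =
    preserves a x , λ w y z → none (from a w) (adj-from a w y) (adj-from a w z)

  outer-preserved : ∀ a u → Outer u → Outer (to a u)
  outer-preserved a u o with outer⇒triangleFree u o
  ... | v , tf = triangleFree⇒outer _ _ (triangleFree-preserved a tf)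

  private-preserved : ∀ a u → HasPrivateNbr u → HasPrivateNbr (to a u)
  private-preserved a u (w , x , not-outer , only) =
    to a w , preserves a x , (λ o → not-outer (reflected Outer outer-preserved a w o)) ,
    λ z oz az → trans (sym (to-from a z))
                      (cong (to a) (only (from a z) (outer-preserved (inverse a) z oz) (adj-from a z az)))

  block : V → ℕ
  block u = toℕ (proj₂ u)

  -- Automorphisms preserve blocks 0 and 3 (outer, with/without a private
  -- neighbour), then block 2 (the non-outer vertices adjacent to both
  -- blocks 0 and 3) and block 1 (the remaining non-outer neighbours of block 0).
  block0-preserved : ∀ a u → block u ≡ 0 → block (to a u) ≡ 0
  block0-preserved a (g , i) z with outer-preserved a (g , i) (inj₁ z)
  ... | inj₁ x = x
  ... | inj₂ x = ⊥-elim (¬private3 x (private-preserved a (g , i) (private0 z)))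

  block3-preserved : ∀ a u → block u ≡ 3 → block (to a u) ≡ 3
  block3-preserved a u z with outer-preserved a u (inj₂ z)
  ... | inj₁ x = ⊥-elim (c≢ z (reflected (λ v → block v ≡ 0) block0-preserved a u x))
  ... | inj₂ x = x

  inner : ∀ u → block u ≡ 1 ⊎ block u ≡ 2 → ¬ Outer u
  inner u (inj₁ z) (inj₁ x) = c≢ z x
  inner u (inj₁ z) (inj₂ x) = c≢ z x
  inner u (inj₂ z) (inj₁ x) = c≢ z x
  inner u (inj₂ z) (inj₂ x) = c≢ z x

  block2-by-nbrs : ∀ {h j a b c d} → ¬ Outer (h , j) → Adj (a , b) (h , j) → toℕ b ≡ 0
                   → Adj (c , d) (h , j) → toℕ d ≡ 3 → toℕ j ≡ 2
  block2-by-nbrs inner x₀ z₀ x₃ z₃ with nbrs0 z₀ x₀ | nbrs3 z₃ x₃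
  ... | inj₁ (q , _) | inj₁ (q' , _) = ⊥-elim (c≢ q q')
  ... | inj₁ (q , _) | inj₂ (inj₁ (q' , _)) = ⊥-elim (≥≢ (4≤-L q') q)
  ... | inj₁ (q , _) | inj₂ (inj₂ q') = ⊥-elim (c≢ q q')
  ... | inj₂ (inj₁ (q , _)) | _ = q
  ... | inj₂ (inj₂ q) | _ = ⊥-elim (inner (inj₂ q))

  block12-by-nbrs : ∀ {h j a b} → ¬ Outer (h , j) → Adj (a , b) (h , j) → toℕ b ≡ 0 → toℕ j ≡ 1 ⊎ toℕ j ≡ 2
  block12-by-nbrs inner x₀ z₀ with nbrs0 z₀ x₀
  ... | inj₁ (q , _) = inj₁ q
  ... | inj₂ (inj₁ (q , _)) = inj₂ q
  ... | inj₂ (inj₂ q) = ⊥-elim (inner (inj₂ q))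

  block1-no-block3 : ∀ {g i h j} → toℕ i ≡ 1 → Adj (g , i) (h , j) → toℕ j ≡ 3 → ⊥
  block1-no-block3 z a j≡3 with nbrs1 z a
  ... | inj₁ (q , _) = c≢ j≡3 q
  ... | inj₂ (inj₁ (q , _)) = c≢ j≡3 q
  ... | inj₂ (inj₂ (inj₁ (q , _))) = c≢ j≡3 q
  ... | inj₂ (inj₂ (inj₂ (q , _))) = c≢ j≡3 q

  block2-preserved : ∀ a u → block u ≡ 2 → block (to a u) ≡ 2
  block2-preserved a (g , i) z =
    block2-by-nbrs (λ o → inner (g , i) (inj₂ z) (reflected Outer outer-preserved a (g , i) o))
      (adj-sym (preserves a (inj₂ (e02 toℕ-I0 z (⊕gen≢ g))))) (block0-preserved a (g ⊕ gen n , I0) toℕ-I0)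
      (adj-sym (preserves a (inj₁ (e23 z toℕ-I3 refl)))) (block3-preserved a (g , I3) toℕ-I3)

  -- the image of g₁ cannot be in block 2, whose vertices have block-3 neighbours
  block1-preserved : ∀ a u → block u ≡ 1 → block (to a u) ≡ 1
  block1-preserved a (g , i) z
    with block12-by-nbrs (λ o → inner (g , i) (inj₁ z) (reflected Outer outer-preserved a (g , i) o))
           (adj-sym (preserves a (inj₂ (e01 toℕ-I0 z (sym (⊖⊕-cancel g (gen n)))))))
           (block0-preserved a (g ⊕ gen⁻¹ , I0) toℕ-I0)
  ... | inj₁ q = q
  ... | inj₂ q = ⊥-elim (block1-no-block3 z (adj-from a w₃ (inj₁ (e23 q toℕ-I3 refl)))
                                            (block3-preserved (inverse a) w₃ toℕ-I3))
    where
    w₃ : V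
    w₃ = (proj₁ (to a (g , i)) , I3)

  module Rigid (a : Automorphism) where

    same-block : ∀ (v : V) (k : Fin m) → toℕ (proj₂ v) ≡ toℕ k → v ≡ (proj₁ v , k)
    same-block (g , i) k q = cong (g ,_) (toℕ-injective q)

    F : Fin n → Fin n
    F g = proj₁ (to a (g , I0))

    on-block0 : ∀ g → to a (g , I0) ≡ (F g , I0)
    on-block0 g = same-block _ I0 (trans (block0-preserved a (g , I0) toℕ-I0) (sym toℕ-I0))

    -- (g x)₁ is the unique block-1 neighbour of g₀
    on-block1 : ∀ g → to a (g ⊕ gen n , I1) ≡ (F g ⊕ gen n , I1)
    on-block1 g with nbrs0 toℕ-I0 (subst (λ u → Adj u (to a (g ⊕ gen n , I1))) (on-block0 g)
                                         (preserves a (inj₁ (e01 toℕ-I0 toℕ-I1 refl))))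
    ... | inj₁ (q , r) = trans (same-block _ I1 (trans q (sym toℕ-I1))) (cong (_, I1) r)
    ... | inj₂ (inj₁ (q , _)) = ⊥-elim (c≢ (block1-preserved a (g ⊕ gen n , I1) toℕ-I1) q)
    ... | inj₂ (inj₂ q) = ⊥-elim (c≢ (block1-preserved a (g ⊕ gen n , I1) toℕ-I1) q)

    -- (g x^δ)₂ is the unique block-2 neighbour of g₁
    on-block2-via1 : ∀ g → to a ((g ⊕ gen n) ⊕ δ , I2) ≡ ((F g ⊕ gen n) ⊕ δ , I2)
    on-block2-via1 g with nbrs1 toℕ-I1 (subst (λ u → Adj u (to a ((g ⊕ gen n) ⊕ δ , I2))) (on-block1 g)
                                              (preserves a (inj₁ (e12 toℕ-I1 toℕ-I2 refl))))
    ... | inj₁ (q , _) = ⊥-elim (c≢ (block2-preserved a _ toℕ-I2) q)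
    ... | inj₂ (inj₁ (q , _)) = ⊥-elim (c≢ (block2-preserved a _ toℕ-I2) q)
    ... | inj₂ (inj₂ (inj₁ (q , r))) = trans (same-block _ I2 (trans q (sym toℕ-I2))) (cong (_, I2) r)
    ... | inj₂ (inj₂ (inj₂ (q , _))) = ⊥-elim (c≢ (block2-preserved a _ toℕ-I2) q)

    -- g₂ is the unique block-2 vertex not adjacent to g₀
    on-block2-via0 : ∀ g → to a (g , I2) ≡ (F g , I2)
    on-block2-via0 g with proj₁ (to a (g , I2)) ≟ F g
    ... | yes p = trans (same-block _ I2 (trans (block2-preserved a (g , I2) toℕ-I2) (sym toℕ-I2))) (cong (_, I2) p)
    ... | no ne with nbrs0 toℕ-I0 (reflects a adj)
      where
      adj : Adj (to a (g , I0)) (to a (g , I2))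
      adj = subst (λ u → Adj u (to a (g , I2))) (sym (on-block0 g))
                  (inj₁ (e02 toℕ-I0 (block2-preserved a (g , I2) toℕ-I2) (λ x → ne (sym x))))
    ...   | inj₁ (q , _) = ⊥-elim (c≢ toℕ-I2 q)
    ...   | inj₂ (inj₁ (_ , r)) = ⊥-elim (r refl)
    ...   | inj₂ (inj₂ q) = ⊥-elim (c≢ toℕ-I2 q)

    -- comparing the two descriptions of block 2: F commutes with s
    F-⊕s : ∀ g → F (g ⊕ s) ≡ F g ⊕ s
    F-⊕s g = begin
      F (g ⊕ s)            ≡⟨ cong F (⊕-assoc g (gen n) δ) ⟨
      F ((g ⊕ gen n) ⊕ δ)  ≡⟨ cong proj₁ (trans (sym (on-block2-via0 _)) (on-block2-via1 g)) ⟩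
      (F g ⊕ gen n) ⊕ δ    ≡⟨ ⊕-assoc (F g) (gen n) δ ⟩
      F g ⊕ s              ∎
      where open ≡-Reasoning

    c : Fin n
    c = F 0ᴳ

    F-multiple : ∀ k → F (k · s) ≡ c ⊕ k · s
    F-multiple zero = sym (⊕-identityʳ c)
    F-multiple (suc k) = begin
      F (k · s ⊕ s)    ≡⟨ F-⊕s (k · s) ⟩
      F (k · s) ⊕ s    ≡⟨ cong (_⊕ s) (F-multiple k) ⟩
      (c ⊕ k · s) ⊕ s  ≡⟨ ⊕-assoc c (k · s) s ⟩
      c ⊕ (k · s ⊕ s)  ∎
      where open ≡-Reasoning

    -- since s generates G, F is the translation by c
    F-translation : ∀ g → F g ≡ g ⊕ c
    F-translation g with s-generates g
    ... | k , p = trans (cong F (sym p)) (trans (F-multiple k) (trans (cong (c ⊕_) p) (⊕-comm c g)))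

    agrees0 : ∀ g → to a (g , I0) ≡ act c (g , I0)
    agrees0 g = trans (on-block0 g) (cong (_, I0) (F-translation g))

    agrees1 : ∀ g → to a (g , I1) ≡ act c (g , I1)
    agrees1 g = begin
      to a (g , I1)                       ≡⟨ cong (λ x → to a (x , I1)) (⊖⊕-cancel g (gen n)) ⟨
      to a ((g ⊕ gen⁻¹) ⊕ gen n , I1)     ≡⟨ on-block1 (g ⊕ gen⁻¹) ⟩
      (F (g ⊕ gen⁻¹) ⊕ gen n , I1)        ≡⟨ cong (λ x → (x ⊕ gen n , I1)) (F-translation (g ⊕ gen⁻¹)) ⟩
      (((g ⊕ gen⁻¹) ⊕ c) ⊕ gen n , I1)    ≡⟨ cong (_, I1) (⊕-rightComm (g ⊕ gen⁻¹) c (gen n)) ⟩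
      (((g ⊕ gen⁻¹) ⊕ gen n) ⊕ c , I1)    ≡⟨ cong (λ x → (x ⊕ c , I1)) (⊖⊕-cancel g (gen n)) ⟩
      (g ⊕ c , I1)                        ∎
      where open ≡-Reasoning

    agrees2 : ∀ g → to a (g , I2) ≡ act c (g , I2)
    agrees2 g = trans (on-block2-via0 g) (cong (_, I2) (F-translation g))

    -- g₃ is the unique block-3 neighbour of g₂
    agrees3 : ∀ g → to a (g , I3) ≡ act c (g , I3)
    agrees3 g with nbrs2 toℕ-I2 (subst (λ u → Adj u (to a (g , I3))) (agrees2 g)
                                       (preserves a (inj₁ (e23 toℕ-I2 toℕ-I3 refl))))
    ... | inj₁ (q , _) = ⊥-elim (c≢ (block3-preserved a _ toℕ-I3) q)
    ... | inj₂ (inj₁ (q , _)) = ⊥-elim (c≢ (block3-preserved a _ toℕ-I3) q)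
    ... | inj₂ (inj₂ (inj₁ (q , _))) = ⊥-elim (c≢ (block3-preserved a _ toℕ-I3) q)
    ... | inj₂ (inj₂ (inj₂ (q , r))) = trans (same-block _ I3 (trans q (sym toℕ-I3))) (cong (_, I3) (sym r))

    AgreesBelow : ℕ → Set
    AgreesBelow l = ∀ (j : Fin m) → toℕ j < l → ∀ g → to a (g , j) ≡ act c (g , j)

    agreesBelow4 : AgreesBelow 4
    agreesBelow4 j j<4 g with blockView (toℕ j)
    ... | inj₁ q = subst (λ k → to a (g , k) ≡ act c (g , k)) (block-eq toℕ-I0 q) (agrees0 g)
    ... | inj₂ (inj₁ q) = subst (λ k → to a (g , k) ≡ act c (g , k)) (block-eq toℕ-I1 q) (agrees1 g)
    ... | inj₂ (inj₂ (inj₁ q)) = subst (λ k → to a (g , k) ≡ act c (g , k)) (block-eq toℕ-I2 q) (agrees2 g)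
    ... | inj₂ (inj₂ (inj₂ (inj₁ q))) = subst (λ k → to a (g , k) ≡ act c (g , k)) (block-eq toℕ-I3 q) (agrees3 g)
    ... | inj₂ (inj₂ (inj₂ (inj₂ q))) = ⊥-elim (<⇒≱ j<4 q)

    -- The image (h', j') of g_i is adjacent to
    -- (g x c)_prev; it cannot lie below i (a is injective), so j' = i, and
    -- h' = g c, since otherwise (h' c⁻¹)_prev ~ g_i would map to h'_prev ~ h'_i.
    agreesChain : ∀ i → 4 ≤ toℕ i → AgreesBelow (toℕ i) → ∀ g → to a (g , i) ≡ act c (g , i)
    agreesChain i i≥4 below g with to a (g , i) in eq
    ... | (h' , j') = locate (prev-nbrs image-adj)
      where
      open PrevBlock (prevBlock i i≥4)
      image-adj : Adj ((g ⊕ gen n) ⊕ c , prev) (h' , j')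
      image-adj = subst₂ Adj (below prev prev< (g ⊕ gen n)) eq (preserves a (inj₁ (prev-edge (⊕gen≢ g))))
      locate : toℕ j' < toℕ i ⊎ (j' ≡ i × (g ⊕ gen n) ⊕ c ≢ h') → (h' , j') ≡ (g ⊕ c , i)
      locate (inj₁ j'<i) = ⊥-elim (<-irrefl (cong block preimage) j'<i)
        where
        preimage : (h' ⊕ ⊖ c , j') ≡ (g , i)
        preimage = to-injective a (trans (below j' j'<i (h' ⊕ ⊖ c)) (trans (cong (_, j') (⊖⊕-cancel h' c)) (sym eq)))
      locate (inj₂ (refl , _)) with h' ≟ g ⊕ c
      ... | yes q = cong (_, j') q
      ... | no ne with prev-nbrs (subst₂ Adj (trans (below prev prev< k) (cong (_, prev) (⊖⊕-cancel h' c))) eq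
                                              (preserves a (inj₁ (prev-edge k≢g))))
        where
        k : Fin n
        k = h' ⊕ ⊖ c
        k≢g : k ≢ g
        k≢g q = ne (trans (sym (⊖⊕-cancel h' c)) (cong (_⊕ c) q))
      ...   | inj₁ j'<j' = ⊥-elim (<-irrefl refl j'<j')
      ...   | inj₂ (_ , h'≢h') = ⊥-elim (h'≢h' refl)

    agreesBelow : ∀ l → AgreesBelow l
    agreesBelow zero j () g
    agreesBelow (suc l) j j<1+l g with m<1+n⇒m<n∨m≡n j<1+l
    ... | inj₁ j<l = agreesBelow l j j<l g
    ... | inj₂ j≡l with 4 ≤? toℕ j
    ...   | yes j≥4 = agreesChain j j≥4 (subst AgreesBelow (sym j≡l) (agreesBelow l)) g
    ...   | no j≱4 = agreesBelow4 j (≰⇒> j≱4) g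

    rigid : ∀ v → to a v ≡ act c v
    rigid (g , i) = agreesBelow (suc (toℕ i)) i ≤-refl g

  automorphism-is-translation : (f : V → V) → IsAutΔ f → Σ (Fin n) λ c → (v : V) → f v ≡ act c v
  automorphism-is-translation f isAut = Rigid.c (fromIsAut f isAut) , Rigid.rigid (fromIsAut f isAut)

module Encoded {V : Set} (Adj : V → V → Set) (adj? : ∀ u v → Dec (Adj u v))
               {k : ℕ} (enc : V → Fin k) (dec : Fin k → V)
               (enc-dec : ∀ x → enc (dec x) ≡ x) (dec-enc : ∀ v → dec (enc v) ≡ v) where

  A : Fin k → Fin k → Bool
  A x y = isYes (adj? (dec x) (dec y))

  A-true : ∀ {x y} → A x y ≡ true → Adj (dec x) (dec y)
  A-true {x} {y} p with adj? (dec x) (dec y)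
  ... | yes a = a

  true-A : ∀ {x y} → Adj (dec x) (dec y) → A x y ≡ true
  true-A {x} {y} a with adj? (dec x) (dec y)
  ... | yes _ = refl
  ... | no ¬a = ⊥-elim (¬a a)

  A-cong : ∀ {x y x' y'} → (Adj (dec x) (dec y) → Adj (dec x') (dec y'))
           → (Adj (dec x') (dec y') → Adj (dec x) (dec y)) → A x y ≡ A x' y'
  A-cong {x} {y} {x'} {y'} f g with adj? (dec x) (dec y) | adj? (dec x') (dec y')
  ... | yes _ | yes _ = refl
  ... | yes p | no ¬q = ⊥-elim (¬q (f p))
  ... | no ¬p | yes q = ⊥-elim (¬p (g q))
  ... | no _  | no _  = refl

  enc-injective : ∀ {u v} → enc u ≡ enc v → u ≡ v
  enc-injective {u} {v} p = trans (sym (dec-enc u)) (trans (cong dec p) (dec-enc v))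

  dec-injective : ∀ {x y} → dec x ≡ dec y → x ≡ y
  dec-injective {x} {y} p = trans (sym (enc-dec x)) (trans (cong enc p) (enc-dec y))

  simple : (∀ {u v} → Adj u v → Adj v u) → (∀ v → ¬ Adj v v) → IsSimple A
  simple adj-sym irrefl = (λ u v → A-cong adj-sym adj-sym) , loopless
    where
    loopless : ∀ v → A v v ≡ false
    loopless v with adj? (dec v) (dec v)
    ... | yes a = ⊥-elim (irrefl (dec v) a)
    ... | no _ = refl

  nbr-≡ : ∀ {x w w'} {p : A x w ≡ true} {p' : A x w' ≡ true} → w ≡ w'
          → _≡_ {A = Σ (Fin k) (λ w → A x w ≡ true)} (w , p) (w' , p')
  nbr-≡ {w = w} {p = p} {p'} refl = cong (w ,_) (Decidable⇒UIP.≡-irrelevant Bool._≟_ p p')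

  nbrs↔ : ∀ {I : Set} x (e : I → V) → (∀ {i j} → e i ≡ e j → i ≡ j) → (∀ i → Adj (dec x) (e i))
          → (∀ w → Adj (dec x) w → Σ I λ i → e i ≡ w) → I ↔ Σ (Fin k) (λ w → A x w ≡ true)
  nbrs↔ {I} x e e-inj e-sound e-complete = mk↔ₛ′ to from to-from from-to
    where
    to : I → Σ (Fin k) (λ w → A x w ≡ true)
    to i = enc (e i) , true-A (subst (Adj (dec x)) (sym (dec-enc _)) (e-sound i))
    from : Σ (Fin k) (λ w → A x w ≡ true) → I
    from (w , p) = proj₁ (e-complete (dec w) (A-true p))
    to-from : ∀ y → to (from y) ≡ y
    to-from (w , p) = nbr-≡ (trans (cong enc (proj₂ (e-complete (dec w) (A-true p)))) (enc-dec w))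
    from-to : ∀ i → from (to i) ≡ i
    from-to i = e-inj (trans (proj₂ (e-complete _ _)) (dec-enc (e i)))

  IsAutV : (V → V) → Set
  IsAutV f = Bijective _≡_ _≡_ f × (∀ u v → Adj u v ⇔ Adj (f u) (f v))

  adj-dec-enc : ∀ {u v} → Adj u v → Adj (dec (enc u)) (dec (enc v))
  adj-dec-enc {u} {v} = subst₂ Adj (sym (dec-enc u)) (sym (dec-enc v))

  adj-dec-enc⁻ : ∀ {u v} → Adj (dec (enc u)) (dec (enc v)) → Adj u v
  adj-dec-enc⁻ {u} {v} = subst₂ Adj (dec-enc u) (dec-enc v)

  aut-encode : ∀ f → IsAutV f → IsAut A (λ x → enc (f (dec x)))
  aut-encode f ((f-inj , f-surj) , f-adj) = (inj , surj) , λ u v →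
      A-cong (λ a → Equivalence.from (f-adj (dec u) (dec v)) (adj-dec-enc⁻ a))
             (λ a → adj-dec-enc (Equivalence.to (f-adj (dec u) (dec v)) a))
    where
    inj : ∀ {x y} → enc (f (dec x)) ≡ enc (f (dec y)) → x ≡ y
    inj p = dec-injective (f-inj (enc-injective p))
    surj : ∀ y → ∃ λ x → ∀ {z} → z ≡ x → enc (f (dec z)) ≡ y
    surj y = enc (proj₁ (f-surj (dec y))) , λ { refl →
      trans (cong (λ t → enc (f t)) (dec-enc _)) (trans (cong enc (proj₂ (f-surj (dec y)) refl)) (enc-dec y)) }

  aut-decode : ∀ F → IsAut A F → IsAutV (λ v → dec (F (enc v)))
  aut-decode F ((F-inj , F-surj) , F-adj) = (inj , surj) , λ u v → mk⇔
      (λ a → A-true (trans (F-adj (enc u) (enc v)) (true-A (adj-dec-enc a))))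
      (λ a → adj-dec-enc⁻ (A-true (trans (sym (F-adj (enc u) (enc v))) (true-A a))))
    where
    inj : ∀ {u v} → dec (F (enc u)) ≡ dec (F (enc v)) → u ≡ v
    inj p = enc-injective (F-inj (dec-injective p))
    surj : ∀ y → ∃ λ x → ∀ {z} → z ≡ x → dec (F (enc z)) ≡ y
    surj y = dec (proj₁ (F-surj (enc y))) , λ { refl →
      trans (cong (λ t → dec (F t)) (enc-dec _)) (trans (cong dec (proj₂ (F-surj (enc y)) refl)) (dec-enc y)) }

module GRR (n m : ℕ) .{{_ : NonZero n}} (n≥3 : 3 ≤ n) (m≥5 : 5 ≤ m) where
  open CyclicGroup n

  gcd-one : gcd (1 + toℕ 0ᴳ) n ≡ 1
  gcd-one = trans (cong (λ t → gcd (1 + t) n) toℕ-0ᴳ) (gcd-zeroˡ n)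

  open Delta n m 0ᴳ
  open Graph n m n≥3 m≥5 0ᴳ
  open Regularity n m n≥3 m≥5 0ᴳ
  open Rigidity n m n≥3 m≥5 0ᴳ gcd-one using (automorphism-is-translation)

  enc : V → Fin (n * m)
  enc = uncurry combine

  dec : Fin (n * m) → V
  dec = remQuot m

  dec-enc : ∀ v → dec (enc v) ≡ v
  dec-enc (g , i) = remQuot-combine g i

  enc-dec : ∀ x → enc (dec x) ≡ x
  enc-dec = combine-remQuot {n} m

  open Encoded Adj decAdj enc dec enc-dec dec-enc

  regular : IsRegular A
  regular = n + n , degree
    where
    degree : ∀ x → Fin (n + n) ↔ Σ (Fin (n * m)) (λ w → A x w ≡ true)
    degree x = ↔-trans +↔⊎ (nbrs↔ x enum injective sound complete)
      where open NbrEnumeration (nbrEnumeration (dec x))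

  φ : Fin n → Fin (n * m) → Fin (n * m)
  φ g x = enc (act g (dec x))

  dec-φ : ∀ g x → dec (φ g x) ≡ act g (dec x)
  dec-φ g x = dec-enc _

  φ-⊕ : ∀ g h x → φ (g ⊕ h) x ≡ φ g (φ h x)
  φ-⊕ g h x = cong enc (trans (act-⊕ g h (dec x)) (cong (act g) (sym (dec-φ h x))))

  φ-faithful : ∀ g h → (∀ x → φ g x ≡ φ h x) → g ≡ h
  φ-faithful g h p = act-faithful g h λ v → begin
    act g v              ≡⟨ cong (act g) (dec-enc v) ⟨
    act g (dec (enc v))  ≡⟨ dec-φ g (enc v) ⟨
    dec (φ g (enc v))    ≡⟨ cong dec (p (enc v)) ⟩
    dec (φ h (enc v))    ≡⟨ dec-φ h (enc v) ⟩
    act h (dec (enc v))  ≡⟨ cong (act h) (dec-enc v) ⟩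
    act h v              ∎
    where open ≡-Reasoning

  φ-onto : ∀ F → IsAut A F → Σ (Fin n) λ g → ∀ x → F x ≡ φ g x
  φ-onto F isAut with automorphism-is-translation (λ v → dec (F (enc v))) (aut-decode F isAut)
  ... | g , agrees = g , λ x → (begin
    F x                          ≡⟨ enc-dec (F x) ⟨
    enc (dec (F x))              ≡⟨ cong (λ y → enc (dec (F y))) (enc-dec x) ⟨
    enc (dec (F (enc (dec x))))  ≡⟨ cong enc (agrees (dec x)) ⟩
    φ g x                        ∎)
    where open ≡-Reasoning

  φ-free : ∀ g x → φ g x ≡ x → g ≡ 0ᴳ
  φ-free g x p = act-free g (dec x) (trans (sym (dec-φ g x)) (cong dec p))

  rep : Fin m → Fin (n * m)
  rep j = enc (0ᴳ , j)

  orbits-cover : ∀ x → Σ (Fin m) λ j → Σ (Fin n) λ g → x ≡ φ g (rep j)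
  orbits-cover x with dec x in eq
  ... | (g , j) = j , g , (begin
    x                        ≡⟨ enc-dec x ⟨
    enc (dec x)              ≡⟨ cong enc eq ⟩
    enc (g , j)              ≡⟨ cong (λ y → enc (y , j)) (⊕-identityˡ g) ⟨
    enc (act g (0ᴳ , j))     ≡⟨ cong (λ v → enc (act g v)) (dec-enc (0ᴳ , j)) ⟨
    φ g (rep j)              ∎)
    where open ≡-Reasoning

  orbits-distinct : ∀ j j' g → rep j ≡ φ g (rep j') → j ≡ j'
  orbits-distinct j j' g p =
    cong proj₂ (trans (sym (dec-enc (0ᴳ , j))) (trans (cong dec p) (trans (dec-φ g (rep j'))
      (cong (act g) (dec-enc (0ᴳ , j'))))))

  hasMGRR : HasMGRR n m
  hasMGRR = n * m , A , simple adj-sym irreflexive , regular , φ ,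
            (λ g → aut-encode (act g) (isAut-act g)) , φ-⊕ , φ-faithful , φ-onto , φ-free ,
            rep , orbits-cover , orbits-distinct

lemma4p7 : ((n m : ℕ) .{{_ : NonZero n}} → 3 ≤ n → 5 ≤ m → (δ : Fin n)
    → gcd (1 + toℕ δ) n ≡ 1
    → let open Delta n m δ in
    ((g : Fin n) → IsAutΔ (act g))
    × ((g h : Fin n) → ((v : V) → act g v ≡ act h v) → g ≡ h)
    × ((f : V → V) → IsAutΔ f → Σ (Fin n) λ g → (v : V) → f v ≡ act g v))
    × ((n m : ℕ) .{{_ : NonZero n}} → 3 ≤ n → 5 ≤ m → HasMGRR n m)
lemma4p7 = automorphismGroup , GRR.hasMGRR
  where
  automorphismGroup : (n m : ℕ) .{{_ : NonZero n}} → 3 ≤ n → 5 ≤ m → (δ : Fin n)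
    → gcd (1 + toℕ δ) n ≡ 1
    → let open Delta n m δ in
    ((g : Fin n) → IsAutΔ (act g))
    × ((g h : Fin n) → ((v : V) → act g v ≡ act h v) → g ≡ h)
    × ((f : V → V) → IsAutΔ f → Σ (Fin n) λ g → (v : V) → f v ≡ act g v)
  automorphismGroup n m n≥3 m≥5 δ cop = isAut-act , act-faithful , automorphism-is-translation
    where
    open Graph n m n≥3 m≥5 δ
    open Rigidity n m n≥3 m≥5 δ cop
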